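{- Let $n\ge 3$ and consider the right lobster $\mathcal{L}^{1,1}_{n-2}$ (with $n$ cells). Then the poset $\mathrm{SET}(\mathcal{L}^{1,1}_{n-2})$ is isomorphic to (a) the root poset of the root system $A_{n-1}$, and also to (b) the poset $\mathbb{N}^2$ truncated at corank $n-2$, i.e. the set $\{(i,j)\in\mathbb{N}^2: i+j\le n-2\}$ with $(k,l)\le(i,j)$ iff $k\ge i$ and $l\ge j$. It has $n-1$ minimal elements $M_{i+1,i}$, $1\le i\le n-1$, where $M_{i+1,i}$ is the unique filling of the lobster in which $i$ and $i+1$ occupy the two claw cells. In particular all minimal elements have the same number of inversions. The cardinality of $\mathrm{SET}(\mathcal{L}^{1,1}_{n-2})$ is $\binom{n}{2}$.
   Context: Compositions, diagrams (rows numbered from bottom), and skew diagrams $\alpha/\beta$ for $\beta\subseteq\alpha$ are as usual: $\alpha/\beta$ is the set of cells of the diagram of $\alpha$ (with $\alpha_i$ left-justified cells in row $i$) not in that of $\beta$. For positive integers $b,c_1,c_2$, the right lobster $\mathcal{L}^{c_1,c_2}_b$ is the skew diagram $\alpha/\beta$ with $\alpha=(b+1+c_2,\,b+1,\,b+1+c_1)$ and $\beta=(b+1,1,b+1)$: the bottom row has $c_2$ cells in columns $b+2,\ldots,b+1+c_2$, the middle row (body) has $b$ cells in columns $2,\ldots,b+1$, and the top row has $c_1$ cells in columns $b+2,\ldots,b+1+c_1$; the top and bottom rows are the claws. For a skew shape with $n$ cells, a standard extended tableau is a bijective filling with $1,\ldots,n$ strictly increasing left to right along rows and bottom to top along columns;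 $\mathrm{SET}$ denotes the set of these. For $1\le i\le n-1$, $\pi_i(T)=T$ if $i+1$ is in a strictly higher row than $i$, $\pi_i(T)=s_i(T)$ (swap $i$ and $i+1$) if $i+1$ is in a strictly lower row than $i$, and $\pi_i(T)=0$ if they are in the same row. Poset on $\mathrm{SET}$: $S\le T$ iff $T$ is obtained from $S$ by a finite sequence of operators $\pi_i$ with all intermediate results nonzero. The reading word of $T$ reads entries right to left along rows, from the top row down; the number of inversions of $T$ is the number of pairs of positions $p<q$ in the reading word with the entry at $p$ larger than the entry at $q$. The root poset of $A_{n-1}$ is the set of positive roots $e_i-e_j$, $1\le i<j\le n$, ordered by $\gamma\le\delta$ iff $\delta-\gamma$ is a nonnegative integer combination of simple roots $e_k-e_{k+1}$. -}

module Defs where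

open import Data.Nat using (ℕ; zero; suc; _+_; _*_; _∸_; _≤_; _<_; _<ᵇ_; _≡ᵇ_)
open import Data.Bool using (Bool; true; false; if_then_else_)
open import Data.List using (List; []; _∷_; map; upTo; length; reverse; zip; _++_)
open import Data.Maybe using (Maybe; just; nothing)
open import Data.Product using (Σ; _×_; _,_; proj₁; proj₂)
import Data.Sum
import Data.Bool
open import Data.Integer as ℤ using (ℤ; +_)
open import Relation.Binary.PropositionalEquality using (_≡_)
open import Relation.Binary.Construct.Closure.ReflexiveTransitive using (Star)
open import Data.List.Membership.Propositional using (_∈_)
open import Data.List.Relation.Binary.Permutation.Propositional using (_↭_)

-- A cell is (row , column), both 1-indexed; rows are numbered from the bottom.
Cell : Set
Cell = ℕ × ℕ

rowCells : ℕ → ℕ → ℕ → List Cell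
rowCells r a b = map (λ k → (r , b + suc k)) (upTo (a ∸ b))

-- cells of α/β, starting at row r, enumerated row by row from the bottom
-- row upwards, and left to right inside each row (β is padded with zeros)
skewCellsFrom : ℕ → List ℕ → List ℕ → List Cell
skewCellsFrom r [] _ = []
skewCellsFrom r (a ∷ α) [] = rowCells r a 0 ++ skewCellsFrom (suc r) α []
skewCellsFrom r (a ∷ α) (b ∷ β) = rowCells r a b ++ skewCellsFrom (suc r) α β

skewCells : List ℕ → List ℕ → List Cell
skewCells α β = skewCellsFrom 1 α β

lobster : ℕ → ℕ → ℕ → List Cell
lobster b c₁ c₂ =
  skewCells (b + 1 + c₂ ∷ b + 1 ∷ b + 1 + c₁ ∷ []) (b + 1 ∷ 1 ∷ b + 1 ∷ [])

L11 : ℕ → List Cell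
L11 n = lobster (n ∸ 2) 1 1

-- Fillings: a filling of the cell list cs is a list T of the same length,
-- T's k-th entry being the entry of the k-th cell of cs.

Filling : Set
Filling = List ℕ

record IsSET (cs : List Cell) (T : Filling) : Set where
  field
    sameLength : length T ≡ length cs
    bijective  : T ↭ map suc (upTo (length cs))
    rowInc : ∀ {r c c' x y} → ((r , c) , x) ∈ zip cs T → ((r , c') , y) ∈ zip cs T →
             c < c' → x < y
    colInc : ∀ {r r' c x y} → ((r , c) , x) ∈ zip cs T → ((r' , c) , y) ∈ zip cs T →
             r < r' → x < y

SET : List Cell → Set
SET cs = Σ Filling (IsSET cs)

_≈SET_ : ∀ {cs} → SET cs → SET cs → Set
S ≈SET T = proj₁ S ≡ proj₁ T

rowOf : List (Cell × ℕ) → ℕ → Maybe ℕ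
rowOf [] v = nothing
rowOf (((r , c) , x) ∷ rest) v = if x ≡ᵇ v then just r else rowOf rest v

entryAt : List (Cell × ℕ) → Cell → Maybe ℕ
entryAt [] p = nothing
entryAt (((r , c) , x) ∷ rest) (r' , c') =
  if (r ≡ᵇ r') Data.Bool.∧ (c ≡ᵇ c') then just x else entryAt rest (r' , c')

swapVal : ℕ → ℕ → ℕ
swapVal i x = if x ≡ᵇ i then suc i else (if x ≡ᵇ suc i then i else x)

-- the operator π_i ; nothing represents 0
π : List Cell → ℕ → Filling → Maybe Filling
π cs i T with rowOf (zip cs T) i | rowOf (zip cs T) (suc i)
... | just r | just r' =
  if r <ᵇ r' then just T
  else (if r' <ᵇ r then just (map (swapVal i) T) else nothing)
... | _ | _ = nothing

Step : List Cell → Filling → Filling → Set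
Step cs S T = Σ ℕ λ i → 1 ≤ i × i < length cs × π cs i S ≡ just T

_≤SET_ : ∀ {cs} → SET cs → SET cs → Set
_≤SET_ {cs} S T = Star (Step cs) (proj₁ S) (proj₁ T)

IsMinimal : (cs : List Cell) → SET cs → Set
IsMinimal cs T = ∀ (S : SET cs) → S ≤SET T → S ≈SET T

-- Since cells are enumerated bottom row first and left to right, reading
-- rows right to left from the top row down is exactly the reversed list.
readingWord : Filling → List ℕ
readingWord T = reverse T

countSmaller : ℕ → List ℕ → ℕ
countSmaller x [] = 0
countSmaller x (y ∷ ys) = (if y <ᵇ x then 1 else 0) + countSmaller x ys

inversions : List ℕ → ℕ
inversions [] = 0
inversions (x ∷ xs) = countSmaller x xs + inversions xs

e : ℕ → ℕ → ℤ
e i m = if i ≡ᵇ m then + 1 else + 0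

posRoot : ℕ → ℕ → (ℕ → ℤ)
posRoot i j m = e i m ℤ.- e j m

simpleRoot : ℕ → (ℕ → ℤ)
simpleRoot k = posRoot k (suc k)

sum1 : ℕ → (ℕ → ℤ) → ℤ
sum1 zero f = + 0
sum1 (suc N) f = sum1 N f ℤ.+ f (suc N)

-- positive roots e_i - e_j, 1 ≤ i < j ≤ n, represented by (i , j)
Root : ℕ → Set
Root n = Σ (ℕ × ℕ) λ ij → 1 ≤ proj₁ ij × proj₁ ij < proj₂ ij × proj₂ ij ≤ n

_≈R_ : ∀ {n} → Root n → Root n → Set
γ ≈R δ = proj₁ γ ≡ proj₁ δ

RootLeq : (n : ℕ) → Root n → Root n → Set
RootLeq n ((i , j) , _) ((k , l) , _) =
  Σ (ℕ → ℕ) λ c → ∀ m →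
    posRoot k l m ℤ.- posRoot i j m ≡ sum1 (n ∸ 1) (λ t → + (c t) ℤ.* simpleRoot t m)

Trunc : ℕ → Set
Trunc n = Σ (ℕ × ℕ) λ ij → proj₁ ij + proj₂ ij ≤ n ∸ 2

_≈Tr_ : ∀ {n} → Trunc n → Trunc n → Set
p ≈Tr q = proj₁ p ≡ proj₁ q

TruncLeq : (n : ℕ) → Trunc n → Trunc n → Set
TruncLeq n ((k , l) , _) ((i , j) , _) = i ≤ k × j ≤ l

record PosetIso {A B : Set} (_≈A_ _≤A_ : A → A → Set) (_≈B_ _≤B_ : B → B → Set) : Set where
  field
    to        : A → B
    from      : B → A
    to-cong   : ∀ a a' → a ≈A a' → to a ≈B to a'
    from-cong : ∀ b b' → b ≈B b' → from b ≈A from b'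
    from∘to   : ∀ a → from (to a) ≈A a
    to∘from   : ∀ b → to (from b) ≈B b
    monotone  : ∀ a a' → a ≤A a' → to a ≤B to a'
    reflects  : ∀ a a' → to a ≤B to a' → a ≤A a'

ClawsAre : ℕ → ℕ → Filling → Set
ClawsAre n i T =
  (entryAt (zip (L11 n) T) (1 , n) ≡ just i × entryAt (zip (L11 n) T) (3 , n) ≡ just (suc i))
  Data.Sum.⊎
  (entryAt (zip (L11 n) T) (1 , n) ≡ just (suc i) × entryAt (zip (L11 n) T) (3 , n) ≡ just i)

-- A standard extended tableau of L^{1,1}_{n-2} is determined by its two claw entries a < b: the
-- body is a single row, so it must hold the remaining values increasingly.  On such a tableau
-- π_i is the identity or 0, except that it moves the bottom claw entry from i + 1 down to i when
-- i + 1 = a, and the top claw entry from i up to i + 1 when i = b.  Hence S ≤ T iff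
-- a_T ≤ a_S and b_S ≤ b_T, which is the order of the positive roots e_a - e_b of A_{n-1}
-- (compare prefix sums of coordinates) and of the points (a - 1, n - b) of the truncated
-- quadrant.  The minimal tableaux are those with b = a + 1, and there are n choose 2 pairs.

module Submission where

open import Defs
open import Data.Nat using (ℕ; zero; suc; _+_; _*_; _∸_; _≤_; _<_; _<ᵇ_; _≡ᵇ_; z≤n; s≤s; _≤?_; _≟_)
open import Data.Nat.Properties
open import Data.Nat.Combinatorics using (_C_; nC1≡n; nCk+nC[k+1]≡[n+1]C[k+1])
open import Data.Bool using (true; false; if_then_else_)
open import Data.List using (List; []; _∷_; map; upTo; applyUpTo; length; reverse; zip; filter; _++_; initLast; _∷ʳ′_)
open import Data.List.Properties
  using (length-++; length-map; map-++; map-applyUpTo; filter-++; filter-all; reverse-++; unfold-reverse; length-reverse)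
open import Data.Maybe using (Maybe; just; nothing)
open import Data.Maybe.Properties using (just-injective)
open import Data.Product using (Σ; _×_; _,_; proj₁; proj₂; uncurry)
open import Data.Sum using (_⊎_; inj₁; inj₂)
open import Data.Empty using (⊥-elim)
open import Function.Base using (id; _∘_; case_of_)
open import Function.Bundles using (_⇔_; mk⇔; Equivalence)
open import Relation.Nullary using (¬_; yes; no; does; ¬?; _×-dec_)
open import Relation.Nullary.Decidable using (does-⇔; dec-true; dec-false)
open import Relation.Unary using (Decidable)
open import Relation.Binary.PropositionalEquality
open import Data.List.Membership.Propositional using (_∈_; _∉_)
open import Data.List.Membership.Propositional.Properties
  using (∈-++⁺ˡ; ∈-++⁺ʳ; ∈-++⁻; ∈-filter⁺; ∈-filter⁻; ∈-map⁺; ∈-map⁻)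
open import Data.List.Membership.Propositional.Properties.WithK using (unique∧set⇒bag)
open import Data.List.Relation.Unary.Any using (here; there)
open import Data.List.Relation.Unary.All as All using (All; []; _∷_)
open import Data.List.Relation.Unary.AllPairs as AllPairs using (AllPairs; []; _∷_)
import Data.List.Relation.Unary.AllPairs.Properties as AllPairs
open import Data.List.Relation.Unary.Unique.Propositional using (Unique)
import Data.List.Relation.Unary.Unique.Propositional.Properties as Unique
open import Data.List.Relation.Unary.Sorted.TotalOrder using (Sorted)
open import Data.List.Relation.Unary.Sorted.TotalOrder.Properties using (↗↭↗⇒≋; AllPairs⇒Sorted)
open import Data.List.Relation.Binary.Pointwise using (Pointwise-≡⇒≡)
open import Data.List.Relation.Binary.BagAndSetEquality using (∼bag⇒↭)
open import Data.List.Relation.Binary.Permutation.Propositional using (_↭_; ↭-sym; ↭⇒↭ₛ)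
open import Data.List.Relation.Binary.Permutation.Propositional.Properties using (∈-resp-↭; ↭-length; ↭-reverse)
import Data.List.Relation.Binary.Permutation.Setoid.Properties as Permutationₛ
open import Relation.Binary.Construct.Closure.ReflexiveTransitive using (Star; ε; _◅_; _◅◅_)
open import Data.Nat.Tactic.RingSolver using (solve-∀)
open import Data.Integer as ℤ using (ℤ; +_; -[1+_])
import Data.Integer.Properties as ℤₚ
import Data.Integer.Tactic.RingSolver as ℤ-Solver
open import Relation.Binary.Definitions using (tri<; tri≈; tri>)

≡ᵇ-refl : ∀ n → (n ≡ᵇ n) ≡ true
≡ᵇ-refl zero = refl
≡ᵇ-refl (suc n) = ≡ᵇ-refl n

≢⇒≡ᵇ-false : ∀ {m n} → m ≢ n → (m ≡ᵇ n) ≡ false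
≢⇒≡ᵇ-false {zero} {zero} m≢n = ⊥-elim (m≢n refl)
≢⇒≡ᵇ-false {zero} {suc n} _ = refl
≢⇒≡ᵇ-false {suc m} {zero} _ = refl
≢⇒≡ᵇ-false {suc m} {suc n} m≢n = ≢⇒≡ᵇ-false (m≢n ∘ cong suc)

≡ᵇ-true⇒≡ : ∀ {m n} → (m ≡ᵇ n) ≡ true → m ≡ n
≡ᵇ-true⇒≡ {zero} {zero} _ = refl
≡ᵇ-true⇒≡ {suc m} {suc n} e = cong suc (≡ᵇ-true⇒≡ e)

<⇒<ᵇ-true : ∀ {m n} → m < n → (m <ᵇ n) ≡ true
<⇒<ᵇ-true {zero} {suc n} _ = refl
<⇒<ᵇ-true {suc m} {suc n} (s≤s m<n) = <⇒<ᵇ-true m<n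

≥⇒<ᵇ-false : ∀ {m n} → n ≤ m → (m <ᵇ n) ≡ false
≥⇒<ᵇ-false {m} {zero} _ = refl
≥⇒<ᵇ-false {suc m} {suc n} (s≤s n≤m) = ≥⇒<ᵇ-false n≤m

suc[a∸1]≡a : ∀ {a} → 1 ≤ a → suc (a ∸ 1) ≡ a
suc[a∸1]≡a {suc a} _ = refl

interval : ℕ → ℕ → List ℕ
interval s zero = []
interval s (suc l) = s ∷ interval (suc s) l

∈-interval⁻ : ∀ {v} s l → v ∈ interval s l → s ≤ v × v < s + l
∈-interval⁻ s (suc l) (here refl) = ≤-refl , subst (s <_) (sym (+-suc s l)) (s≤s (m≤m+n s l))
∈-interval⁻ {v} s (suc l) (there p) with ∈-interval⁻ (suc s) l p
... | s<v , v<s+l = <⇒≤ s<v , subst (v <_) (sym (+-suc s l)) v<s+l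

∈-interval⁺ : ∀ {v} s l → s ≤ v → v < s + l → v ∈ interval s l
∈-interval⁺ {v} s zero s≤v v<s = ⊥-elim (<-irrefl refl (≤-<-trans s≤v (subst (v <_) (+-identityʳ s) v<s)))
∈-interval⁺ {v} s (suc l) s≤v v<s+l with m≤n⇒m<n∨m≡n s≤v
... | inj₂ refl = here refl
... | inj₁ s<v = there (∈-interval⁺ (suc s) l s<v (subst (v <_) (+-suc s l) v<s+l))

length-interval : ∀ s l → length (interval s l) ≡ l
length-interval s zero = refl
length-interval s (suc l) = cong suc (length-interval (suc s) l)

interval-++ : ∀ s k l → interval s (k + l) ≡ interval s k ++ interval (s + k) l
interval-++ s zero l rewrite +-identityʳ s = refl
interval-++ s (suc k) l rewrite +-suc s k = cong (s ∷_) (interval-++ (suc s) k l)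

applyUpTo-interval : ∀ (g : ℕ → ℕ) s l → (∀ k → g k ≡ s + k) → applyUpTo g l ≡ interval s l
applyUpTo-interval g s zero _ = refl
applyUpTo-interval g s (suc l) g≗s+ =
  cong₂ _∷_ (trans (g≗s+ 0) (+-identityʳ s))
    (applyUpTo-interval (g ∘ suc) (suc s) l (λ k → trans (g≗s+ (suc k)) (+-suc s k)))

map-suc-upTo : ∀ n → map suc (upTo n) ≡ interval 1 n
map-suc-upTo n = trans (map-applyUpTo id suc n) (applyUpTo-interval suc 1 n (λ _ → refl))

Increasing : List ℕ → Set
Increasing = AllPairs _<_

Increasing⇒Unique : ∀ {xs} → Increasing xs → Unique xs
Increasing⇒Unique = AllPairs.map <⇒≢

interval-increasing : ∀ s l → Increasing (interval s l)
interval-increasing s zero = []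
interval-increasing s (suc l) =
  All.tabulate (λ v∈ → proj₁ (∈-interval⁻ (suc s) l v∈)) ∷ interval-increasing (suc s) l

unique-⇔⇒↭ : ∀ {xs ys : List ℕ} → Unique xs → Unique ys → (∀ {z} → z ∈ xs ⇔ z ∈ ys) → xs ↭ ys
unique-⇔⇒↭ xs! ys! xs⇔ys = ∼bag⇒↭ (unique∧set⇒bag xs! ys! xs⇔ys)

unique-resp-↭ : ∀ {xs ys : List ℕ} → xs ↭ ys → Unique xs → Unique ys
unique-resp-↭ xs↭ys = Permutationₛ.Unique-resp-↭ (setoid ℕ) (↭⇒↭ₛ xs↭ys)

unique-∷ʳ⇒∉ : ∀ (xs : List ℕ) {x} → Unique (xs ++ x ∷ []) → x ∉ xs
unique-∷ʳ⇒∉ (y ∷ xs) (y≢ ∷ _) (here refl) = All.lookup y≢ (∈-++⁺ʳ xs (here refl)) refl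
unique-∷ʳ⇒∉ (y ∷ xs) (_ ∷ xs!) (there x∈xs) = unique-∷ʳ⇒∉ xs xs! x∈xs

increasing-⇔⇒≡ : ∀ {xs ys} → Increasing xs → Increasing ys → (∀ {z} → z ∈ xs ⇔ z ∈ ys) → xs ≡ ys
increasing-⇔⇒≡ xs↗ ys↗ xs⇔ys = Pointwise-≡⇒≡ (↗↭↗⇒≋ ≤-totalOrder (sorted xs↗) (sorted ys↗)
  (↭⇒↭ₛ (unique-⇔⇒↭ (Increasing⇒Unique xs↗) (Increasing⇒Unique ys↗) xs⇔ys)))
  where
  sorted : ∀ {xs} → Increasing xs → Sorted ≤-totalOrder xs
  sorted xs↗ = AllPairs⇒Sorted ≤-totalOrder (AllPairs.map <⇒≤ xs↗)

swapVal-self : ∀ c → swapVal c c ≡ suc c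
swapVal-self c rewrite ≡ᵇ-refl c = refl

swapVal-suc : ∀ c → swapVal c (suc c) ≡ c
swapVal-suc c rewrite ≢⇒≡ᵇ-false (1+n≢n {c}) | ≡ᵇ-refl c = refl

swapVal-other : ∀ {c v} → v ≢ c → v ≢ suc c → swapVal c v ≡ v
swapVal-other v≢c v≢c+1 rewrite ≢⇒≡ᵇ-false v≢c | ≢⇒≡ᵇ-false v≢c+1 = refl

module _ {P Q : ℕ → Set} (P? : Decidable P) (Q? : Decidable Q) (c : ℕ)
         (agree : ∀ {v} → v ≢ c → v ≢ suc c → Q v ⇔ P v) where

  map-swapVal-filter-avoiding : ∀ xs → All (λ v → v ≢ c × v ≢ suc c) xs →
    map (swapVal c) (filter P? xs) ≡ filter Q? xs
  map-swapVal-filter-avoiding [] [] = refl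
  map-swapVal-filter-avoiding (x ∷ xs) ((x≢c , x≢c+1) ∷ avoid)
    rewrite does-⇔ (agree x≢c x≢c+1) (Q? x) (P? x) with does (P? x)
  ... | true = cong₂ _∷_ (swapVal-other x≢c x≢c+1) (map-swapVal-filter-avoiding xs avoid)
  ... | false = map-swapVal-filter-avoiding xs avoid

  map-swapVal-filter-above : ∀ s l → suc c < s →
    map (swapVal c) (filter P? (interval s l)) ≡ filter Q? (interval s l)
  map-swapVal-filter-above s l c+1<s = map-swapVal-filter-avoiding (interval s l) (All.tabulate λ v∈ →
    let c+1<v = <-≤-trans c+1<s (proj₁ (∈-interval⁻ s l v∈)) in
    (λ { refl → <-asym (n<1+n c) c+1<v }) , (λ { refl → <-irrefl refl c+1<v }))

  -- Were both c and c + 1 kept by the filter, the swap would put them out of order.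
  map-swapVal-filter-interval : ∀ s l → s ≤ c → suc c < s + l →
    (Q c ⇔ P (suc c)) → (Q (suc c) ⇔ P c) → ¬ (P c × P (suc c)) →
    map (swapVal c) (filter P? (interval s l)) ≡ filter Q? (interval s l)
  map-swapVal-filter-interval s zero s≤c c<s =
    ⊥-elim (<-asym (≤-<-trans s≤c (n<1+n c)) (subst (suc c <_) (+-identityʳ s) c<s))
  map-swapVal-filter-interval s (suc l) s≤c c+1<s+l Qc Qc+1 ¬both with m≤n⇒m<n∨m≡n s≤c
  ... | inj₁ s<c rewrite does-⇔ (agree (<⇒≢ s<c) (<⇒≢ (m<n⇒m<1+n s<c))) (Q? s) (P? s) with does (P? s)
  ...   | true = cong₂ _∷_ (swapVal-other (<⇒≢ s<c) (<⇒≢ (m<n⇒m<1+n s<c)))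
                     (map-swapVal-filter-interval (suc s) l s<c (subst (suc c <_) (+-suc s l) c+1<s+l) Qc Qc+1 ¬both)
  ...   | false = map-swapVal-filter-interval (suc s) l s<c (subst (suc c <_) (+-suc s l) c+1<s+l) Qc Qc+1 ¬both
  map-swapVal-filter-interval s (suc zero) _ c+1<s+1 _ _ _ | inj₂ refl =
    ⊥-elim (<-irrefl refl (≤-trans c+1<s+1 (≤-reflexive (+-comm s 1))))
  map-swapVal-filter-interval s (suc (suc l)) _ _ Qc Qc+1 ¬both | inj₂ refl with P? s | P? (suc s)
  ... | yes Ps | yes Ps+1 = ⊥-elim (¬both (Ps , Ps+1))
  ... | yes Ps | no ¬Ps+1
    rewrite dec-false (P? (suc s)) ¬Ps+1 | dec-false (Q? s) (¬Ps+1 ∘ Equivalence.to Qc)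
          | dec-true (Q? (suc s)) (Equivalence.from Qc+1 Ps) =
    cong₂ _∷_ (swapVal-self s) (map-swapVal-filter-above (suc (suc s)) l ≤-refl)
  ... | no ¬Ps | yes Ps+1
    rewrite dec-true (P? (suc s)) Ps+1 | dec-true (Q? s) (Equivalence.from Qc Ps+1)
          | dec-false (Q? (suc s)) (¬Ps ∘ Equivalence.to Qc+1) =
    cong₂ _∷_ (swapVal-suc s) (map-swapVal-filter-above (suc (suc s)) l ≤-refl)
  ... | no ¬Ps | no ¬Ps+1
    rewrite dec-false (P? (suc s)) ¬Ps+1 | dec-false (Q? s) (¬Ps+1 ∘ Equivalence.to Qc)
          | dec-false (Q? (suc s)) (¬Ps ∘ Equivalence.to Qc+1) =
    map-swapVal-filter-above (suc (suc s)) l ≤-refl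

rowFilling : ℕ → ℕ → List ℕ → List (Cell × ℕ)
rowFilling r s [] = []
rowFilling r s (y ∷ ys) = ((r , s) , y) ∷ rowFilling r (suc s) ys

zip-interval-rowFilling : ∀ r s ys → zip (map (r ,_) (interval s (length ys))) ys ≡ rowFilling r s ys
zip-interval-rowFilling r s [] = refl
zip-interval-rowFilling r s (y ∷ ys) = cong (((r , s) , y) ∷_) (zip-interval-rowFilling r (suc s) ys)

∈-rowFilling⁻ : ∀ {r' c x} r s ys → ((r' , c) , x) ∈ rowFilling r s ys →
  r' ≡ r × (s ≤ c × c < s + length ys) × x ∈ ys
∈-rowFilling⁻ r s (y ∷ ys) (here refl) =
  refl , (≤-refl , subst (s <_) (sym (+-suc s _)) (s≤s (m≤m+n s _))) , here refl
∈-rowFilling⁻ {c = c} r s (y ∷ ys) (there p) with ∈-rowFilling⁻ r (suc s) ys p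
... | r'≡r , (s<c , c<s+l) , x∈ys = r'≡r , (<⇒≤ s<c , subst (c <_) (sym (+-suc s _)) c<s+l) , there x∈ys

∈-rowFilling⁺ : ∀ {y} r s ys → y ∈ ys → Σ ℕ λ c → ((r , c) , y) ∈ rowFilling r s ys
∈-rowFilling⁺ r s (y ∷ ys) (here refl) = s , here refl
∈-rowFilling⁺ r s (y ∷ ys) (there p) with ∈-rowFilling⁺ r (suc s) ys p
... | c , q = c , there q

rowFilling-increasing : ∀ {r₁ r₂ c c' x y} r s ys → Increasing ys →
  ((r₁ , c) , x) ∈ rowFilling r s ys → ((r₂ , c') , y) ∈ rowFilling r s ys → c < c' → x < y
rowFilling-increasing r s (y ∷ ys) _ (here refl) (here refl) c<c = ⊥-elim (<-irrefl refl c<c)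
rowFilling-increasing r s (y ∷ ys) (y< ∷ _) (here refl) (there q) _ =
  All.lookup y< (proj₂ (proj₂ (∈-rowFilling⁻ r (suc s) ys q)))
rowFilling-increasing r s (y ∷ ys) _ (there p) (here refl) c'<s =
  ⊥-elim (<-asym c'<s (proj₁ (proj₁ (proj₂ (∈-rowFilling⁻ r (suc s) ys p)))))
rowFilling-increasing r s (y ∷ ys) (_ ∷ ys↗) (there p) (there q) c<c' = rowFilling-increasing r (suc s) ys ys↗ p q c<c'

rowFilling-increasing⁻ : ∀ r s ys →
  (∀ {c c' x y} → ((r , c) , x) ∈ rowFilling r s ys → ((r , c') , y) ∈ rowFilling r s ys → c < c' → x < y) →
  Increasing ys
rowFilling-increasing⁻ r s [] _ = []
rowFilling-increasing⁻ r s (y ∷ ys) rowInc =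
  All.tabulate (λ p → let c , q = ∈-rowFilling⁺ r (suc s) ys p in
                 rowInc (here refl) (there q) (proj₁ (proj₁ (proj₂ (∈-rowFilling⁻ r (suc s) ys q)))))
  ∷ rowFilling-increasing⁻ r (suc s) ys (λ p q → rowInc (there p) (there q))

rowOf-rowFilling-∈ : ∀ {v} r s ys rest → v ∈ ys → rowOf (rowFilling r s ys ++ rest) v ≡ just r
rowOf-rowFilling-∈ {v} r s (y ∷ ys) rest p with y ≡ᵇ v in y≡ᵇv
... | true = refl
rowOf-rowFilling-∈ {v} r s (y ∷ ys) rest (here refl) | false = case trans (sym y≡ᵇv) (≡ᵇ-refl y) of λ ()
rowOf-rowFilling-∈ {v} r s (y ∷ ys) rest (there p) | false = rowOf-rowFilling-∈ r (suc s) ys rest p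

rowOf-rowFilling-∉ : ∀ {v} r s ys rest → v ∉ ys → rowOf (rowFilling r s ys ++ rest) v ≡ rowOf rest v
rowOf-rowFilling-∉ r s [] rest _ = refl
rowOf-rowFilling-∉ {v} r s (y ∷ ys) rest v∉ with y ≡ᵇ v in y≡ᵇv
... | true = ⊥-elim (v∉ (here (sym (≡ᵇ-true⇒≡ y≡ᵇv))))
... | false = rowOf-rowFilling-∉ r (suc s) ys rest (v∉ ∘ there)

entryAt-rowFilling : ∀ {r' c} r s ys rest → r ≢ r' →
  entryAt (rowFilling r s ys ++ rest) (r' , c) ≡ entryAt rest (r' , c)
entryAt-rowFilling r s [] rest _ = refl
entryAt-rowFilling r s (y ∷ ys) rest r≢r' rewrite ≢⇒≡ᵇ-false r≢r' = entryAt-rowFilling r (suc s) ys rest r≢r'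

triangular : ℕ → ℕ
triangular zero = 0
triangular (suc l) = triangular l + l

triangular-+ : ∀ p k → triangular (p + k) ≡ triangular p + triangular k + p * k
triangular-+ p zero rewrite +-identityʳ p | *-zeroʳ p | +-identityʳ (triangular p) = sym (+-identityʳ _)
triangular-+ p (suc k) rewrite +-suc p k | triangular-+ p k | *-suc p k = lemma (triangular p) (triangular k) p k
  where
  lemma : ∀ a b p k → a + b + p * k + (p + k) ≡ a + (b + k) + (p + p * k)
  lemma = solve-∀

crossInversions : List ℕ → List ℕ → ℕ
crossInversions [] ys = 0
crossInversions (x ∷ xs) ys = countSmaller x ys + crossInversions xs ys

countSmaller-++ : ∀ x xs ys → countSmaller x (xs ++ ys) ≡ countSmaller x xs + countSmaller x ys
countSmaller-++ x [] ys = refl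
countSmaller-++ x (y ∷ xs) ys rewrite countSmaller-++ x xs ys = sym (+-assoc (if y <ᵇ x then 1 else 0) _ _)

countSmaller-all : ∀ x ys → All (_< x) ys → countSmaller x ys ≡ length ys
countSmaller-all x [] [] = refl
countSmaller-all x (y ∷ ys) (y<x ∷ ys<x) rewrite <⇒<ᵇ-true y<x = cong suc (countSmaller-all x ys ys<x)

countSmaller-none : ∀ x ys → All (x ≤_) ys → countSmaller x ys ≡ 0
countSmaller-none x [] [] = refl
countSmaller-none x (y ∷ ys) (x≤y ∷ x≤ys) rewrite ≥⇒<ᵇ-false x≤y = countSmaller-none x ys x≤ys

crossInversions-all : ∀ xs ys → All (λ x → All (_< x) ys) xs → crossInversions xs ys ≡ length xs * length ys
crossInversions-all [] ys [] = refl
crossInversions-all (x ∷ xs) ys (ys<x ∷ ys<xs) =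
  cong₂ _+_ (countSmaller-all x ys ys<x) (crossInversions-all xs ys ys<xs)

crossInversions-none : ∀ xs ys → All (λ x → All (x ≤_) ys) xs → crossInversions xs ys ≡ 0
crossInversions-none [] ys [] = refl
crossInversions-none (x ∷ xs) ys (x≤ys ∷ xs≤ys)
  rewrite countSmaller-none x ys x≤ys = crossInversions-none xs ys xs≤ys

crossInversions-++ˡ : ∀ xs ys zs → crossInversions (xs ++ ys) zs ≡ crossInversions xs zs + crossInversions ys zs
crossInversions-++ˡ [] ys zs = refl
crossInversions-++ˡ (x ∷ xs) ys zs rewrite crossInversions-++ˡ xs ys zs = sym (+-assoc (countSmaller x zs) _ _)

inversions-++ : ∀ xs ys → inversions (xs ++ ys) ≡ inversions xs + inversions ys + crossInversions xs ys
inversions-++ [] ys = sym (+-identityʳ _)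
inversions-++ (x ∷ xs) ys rewrite countSmaller-++ x xs ys | inversions-++ xs ys =
  lemma (countSmaller x xs) (countSmaller x ys) (inversions xs) (inversions ys) (crossInversions xs ys)
  where
  lemma : ∀ a b c d e → a + b + (c + d + e) ≡ a + c + d + (b + e)
  lemma = solve-∀

∈-reverse⁻ : ∀ {v} (xs : List ℕ) → v ∈ reverse xs → v ∈ xs
∈-reverse⁻ xs = ∈-resp-↭ (↭-reverse xs)

inversions-reverse-interval : ∀ s l → inversions (reverse (interval s l)) ≡ triangular l
inversions-reverse-interval s zero = refl
inversions-reverse-interval s (suc l) = begin
  inversions (reverse (s ∷ interval (suc s) l))
    ≡⟨ cong inversions (unfold-reverse s (interval (suc s) l)) ⟩
  inversions (reverse (interval (suc s) l) ++ s ∷ [])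
    ≡⟨ inversions-++ (reverse (interval (suc s) l)) (s ∷ []) ⟩
  inversions (reverse (interval (suc s) l)) + 0 + crossInversions (reverse (interval (suc s) l)) (s ∷ [])
    ≡⟨ cong₂ (λ a b → a + 0 + b) (inversions-reverse-interval (suc s) l)
         (crossInversions-all (reverse (interval (suc s) l)) (s ∷ [])
            (All.tabulate λ v∈ → proj₁ (∈-interval⁻ (suc s) l (∈-reverse⁻ (interval (suc s) l) v∈)) ∷ [])) ⟩
  triangular l + 0 + length (reverse (interval (suc s) l)) * 1
    ≡⟨ cong₂ (λ a b → a + b * 1) (+-identityʳ (triangular l))
         (trans (length-reverse (interval (suc s) l)) (length-interval (suc s) l)) ⟩
  triangular l + l * 1
    ≡⟨ cong (λ z → triangular l + z) (*-identityʳ l) ⟩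
  triangular l + l ∎
  where open ≡-Reasoning

-- the reading word of the tableau of L^{1,1}_{p+k} whose claws hold p + 1 (bottom) and p + 2 (top)
inversions-reverse-adjacentClaws : ∀ p k →
  inversions (reverse (suc p ∷ (interval 1 p ++ interval (3 + p) k) ++ (2 + p) ∷ [])) ≡ suc (p + k) + triangular (p + k)
inversions-reverse-adjacentClaws p k = begin
  inversions (reverse (suc p ∷ body ++ (2 + p) ∷ []))
    ≡⟨ cong inversions reverse-word ⟩
  countSmaller (2 + p) ((large ++ small) ++ suc p ∷ []) + inversions ((large ++ small) ++ suc p ∷ [])
    ≡⟨ cong₂ _+_ countSmaller-top inversions-rest ⟩
  0 + p + 1 + (triangular k + triangular p + k * p + 0 + (k * 1 + 0))
    ≡⟨ lemma p k (triangular p) (triangular k) ⟩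
  suc (p + k) + (triangular p + triangular k + p * k)
    ≡⟨ cong (λ z → suc (p + k) + z) (sym (triangular-+ p k)) ⟩
  suc (p + k) + triangular (p + k) ∎
  where
  open ≡-Reasoning
  body large small : List ℕ
  body = interval 1 p ++ interval (3 + p) k
  large = reverse (interval (3 + p) k)
  small = reverse (interval 1 p)
  large-≥ : All (3 + p ≤_) large
  large-≥ = All.tabulate λ v∈ → proj₁ (∈-interval⁻ (3 + p) k (∈-reverse⁻ (interval (3 + p) k) v∈))
  small-< : All (_< 1 + p) small
  small-< = All.tabulate λ v∈ → proj₂ (∈-interval⁻ 1 p (∈-reverse⁻ (interval 1 p) v∈))
  length-large : length large ≡ k
  length-large = trans (length-reverse (interval (3 + p) k)) (length-interval (3 + p) k)
  length-small : length small ≡ p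
  length-small = trans (length-reverse (interval 1 p)) (length-interval 1 p)

  reverse-word : reverse (suc p ∷ body ++ (2 + p) ∷ []) ≡ (2 + p) ∷ (large ++ small) ++ suc p ∷ []
  reverse-word = trans (unfold-reverse (suc p) (body ++ (2 + p) ∷ []))
    (cong (_++ suc p ∷ []) (trans (reverse-++ body ((2 + p) ∷ []))
      (cong ((2 + p) ∷_) (reverse-++ (interval 1 p) (interval (3 + p) k)))))

  countSmaller-top : countSmaller (2 + p) ((large ++ small) ++ suc p ∷ []) ≡ 0 + p + 1
  countSmaller-top = trans (countSmaller-++ (2 + p) (large ++ small) (suc p ∷ []))
    (cong₂ _+_ (trans (countSmaller-++ (2 + p) large small)
                  (cong₂ _+_ (countSmaller-none (2 + p) large (All.map <⇒≤ large-≥))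
                             (trans (countSmaller-all (2 + p) small (All.map m<n⇒m<1+n small-<)) length-small)))
               (countSmaller-all (2 + p) (suc p ∷ []) (≤-refl ∷ [])))

  inversions-body : inversions (large ++ small) ≡ triangular k + triangular p + k * p
  inversions-body = trans (inversions-++ large small)
    (cong₂ _+_ (cong₂ _+_ (inversions-reverse-interval (3 + p) k) (inversions-reverse-interval 1 p))
      (trans (crossInversions-all large small
                (All.map (λ 3+p≤v → All.map (λ w<1+p → <-trans w<1+p (<-trans (n<1+n _) 3+p≤v)) small-<) large-≥))
             (cong₂ _*_ length-large length-small)))

  bottom-inversions : crossInversions (large ++ small) (suc p ∷ []) ≡ k * 1 + 0
  bottom-inversions = trans (crossInversions-++ˡ large small (suc p ∷ []))
    (cong₂ _+_ (trans (crossInversions-all large (suc p ∷ [])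
                         (All.map (λ 3+p≤v → <-trans (n<1+n _) 3+p≤v ∷ []) large-≥))
                      (cong (_* 1) length-large))
               (crossInversions-none small (suc p ∷ []) (All.map (λ v<1+p → <⇒≤ v<1+p ∷ []) small-<)))

  inversions-rest : inversions ((large ++ small) ++ suc p ∷ []) ≡ triangular k + triangular p + k * p + 0 + (k * 1 + 0)
  inversions-rest = trans (inversions-++ (large ++ small) (suc p ∷ []))
    (cong₂ _+_ (cong (_+ 0) inversions-body) bottom-inversions)

  lemma : ∀ p k a b → 0 + p + 1 + (b + a + k * p + 0 + (k * 1 + 0)) ≡ suc (p + k) + (a + b + p * k)
  lemma = solve-∀

-- Sums of integer vectors and the root poset

sum1-cong : ∀ N f g → (∀ t → 1 ≤ t → t ≤ N → f t ≡ g t) → sum1 N f ≡ sum1 N g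
sum1-cong zero f g _ = refl
sum1-cong (suc N) f g f≗g =
  cong₂ ℤ._+_ (sum1-cong N f g (λ t 1≤t t≤N → f≗g t 1≤t (m≤n⇒m≤1+n t≤N)))
              (f≗g (suc N) (s≤s z≤n) ≤-refl)

sum1-≡0 : ∀ N f → (∀ t → 1 ≤ t → t ≤ N → f t ≡ + 0) → sum1 N f ≡ + 0
sum1-≡0 zero f _ = refl
sum1-≡0 (suc N) f f≗0
  rewrite sum1-≡0 N f (λ t 1≤t t≤N → f≗0 t 1≤t (m≤n⇒m≤1+n t≤N))
        | f≗0 (suc N) (s≤s z≤n) ≤-refl = refl

sum1-+ : ∀ N f g → sum1 N (λ t → f t ℤ.+ g t) ≡ sum1 N f ℤ.+ sum1 N g
sum1-+ zero f g = refl
sum1-+ (suc N) f g rewrite sum1-+ N f g = lemma (sum1 N f) (sum1 N g) (f (suc N)) (g (suc N))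
  where
  lemma : ∀ a b c d → a ℤ.+ b ℤ.+ (c ℤ.+ d) ≡ a ℤ.+ c ℤ.+ (b ℤ.+ d)
  lemma = ℤ-Solver.solve-∀

sum1-difference : ∀ N f g → sum1 N (λ x → f x ℤ.- g x) ≡ sum1 N f ℤ.- sum1 N g
sum1-difference zero f g = refl
sum1-difference (suc N) f g rewrite sum1-difference N f g = lemma (sum1 N f) (sum1 N g) (f (suc N)) (g (suc N))
  where
  lemma : ∀ a b c d → a ℤ.- b ℤ.+ (c ℤ.- d) ≡ a ℤ.+ c ℤ.- (b ℤ.+ d)
  lemma = ℤ-Solver.solve-∀

sum1-*ˡ : ∀ N a f → sum1 N (λ x → a ℤ.* f x) ≡ a ℤ.* sum1 N f
sum1-*ˡ zero a f = sym (ℤₚ.*-zeroʳ a)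
sum1-*ˡ (suc N) a f rewrite sum1-*ˡ N a f = sym (ℤₚ.*-distribˡ-+ a (sum1 N f) (f (suc N)))

sum1-comm : ∀ M N (g : ℕ → ℕ → ℤ) →
  sum1 M (λ x → sum1 N (λ t → g t x)) ≡ sum1 N (λ t → sum1 M (λ x → g t x))
sum1-comm zero N g = sym (sum1-≡0 N _ (λ _ _ _ → refl))
sum1-comm (suc M) N g rewrite sum1-comm M N g = sym (sum1-+ N _ _)

δ : ℕ → ℕ → ℕ
δ u t = if u ≡ᵇ t then 1 else 0

δ-refl : ∀ u → δ u u ≡ 1
δ-refl u rewrite ≡ᵇ-refl u = refl

δ-≢ : ∀ {u t} → u ≢ t → δ u t ≡ 0
δ-≢ u≢t rewrite ≢⇒≡ᵇ-false u≢t = refl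

sum1-δ : ∀ N u (f : ℕ → ℤ) → 1 ≤ u → u ≤ N → sum1 N (λ t → + δ u t ℤ.* f t) ≡ f u
sum1-δ zero u f 1≤u u≤0 = ⊥-elim (<-irrefl refl (≤-trans 1≤u u≤0))
sum1-δ (suc N) u f 1≤u u≤N+1 with m≤n⇒m<n∨m≡n u≤N+1
... | inj₁ u<N+1 rewrite sum1-δ N u f 1≤u (≤-pred u<N+1) | δ-≢ (<⇒≢ u<N+1) = ℤₚ.+-identityʳ (f u)
... | inj₂ refl rewrite δ-refl (suc N)
    | sum1-≡0 N (λ t → + δ (suc N) t ℤ.* f t)
        (λ t _ t≤N → cong (λ z → + z ℤ.* f t) (δ-≢ (<⇒≢ (s≤s t≤N) ∘ sym)))
    = trans (ℤₚ.+-identityˡ _) (ℤₚ.*-identityˡ (f (suc N)))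

e-refl : ∀ t → e t t ≡ + 1
e-refl t rewrite ≡ᵇ-refl t = refl

e-≢ : ∀ {t x} → t ≢ x → e t x ≡ + 0
e-≢ t≢x rewrite ≢⇒≡ᵇ-false t≢x = refl

sum1-e-> : ∀ M t → M < t → sum1 M (e t) ≡ + 0
sum1-e-> M t M<t = sum1-≡0 M (e t) (λ x _ x≤M → e-≢ (<⇒≢ (≤-<-trans x≤M M<t) ∘ sym))

sum1-e-≤ : ∀ M t → 1 ≤ t → t ≤ M → sum1 M (e t) ≡ + 1
sum1-e-≤ zero t 1≤t t≤0 = ⊥-elim (<-irrefl refl (≤-trans 1≤t t≤0))
sum1-e-≤ (suc M) t 1≤t t≤M+1 with m≤n⇒m<n∨m≡n t≤M+1
... | inj₁ t<M+1 rewrite sum1-e-≤ M t 1≤t (≤-pred t<M+1) | e-≢ (<⇒≢ t<M+1) = refl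
... | inj₂ refl rewrite sum1-e-> M (suc M) ≤-refl | e-refl (suc M) = refl

sum1-simpleRoot : ∀ M t → 1 ≤ t → sum1 M (simpleRoot t) ≡ + δ M t
sum1-simpleRoot M t 1≤t with <-cmp t M
... | tri< t<M _ _ rewrite sum1-difference M (e t) (e (suc t)) | sum1-e-≤ M t 1≤t (<⇒≤ t<M)
      | sum1-e-≤ M (suc t) (s≤s z≤n) t<M
      | δ-≢ (<⇒≢ t<M ∘ sym) = refl
... | tri≈ _ refl _ rewrite sum1-difference M (e t) (e (suc t)) | sum1-e-≤ t t 1≤t ≤-refl | sum1-e-> t (suc t) ≤-refl
      | δ-refl t = refl
... | tri> _ _ M<t rewrite sum1-difference M (e t) (e (suc t)) | sum1-e-> M t M<t | sum1-e-> M (suc t) (m<n⇒m<1+n M<t)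
      | δ-≢ (<⇒≢ M<t) = refl

prefixSum-simpleRoots : ∀ M N (c : ℕ → ℕ) → 1 ≤ M → M ≤ N →
  sum1 M (λ x → sum1 N (λ t → + c t ℤ.* simpleRoot t x)) ≡ + c M
prefixSum-simpleRoots M N c 1≤M M≤N = begin
  sum1 M (λ x → sum1 N (λ t → + c t ℤ.* simpleRoot t x))
    ≡⟨ sum1-comm M N _ ⟩
  sum1 N (λ t → sum1 M (λ x → + c t ℤ.* simpleRoot t x))
    ≡⟨ sum1-cong N _ _ (λ t 1≤t _ → begin
         sum1 M (λ x → + c t ℤ.* simpleRoot t x) ≡⟨ sum1-*ˡ M (+ c t) (simpleRoot t) ⟩
         + c t ℤ.* sum1 M (simpleRoot t)         ≡⟨ cong (+ c t ℤ.*_) (sum1-simpleRoot M t 1≤t) ⟩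
         + c t ℤ.* + δ M t                       ≡⟨ ℤₚ.*-comm (+ c t) (+ δ M t) ⟩
         + δ M t ℤ.* + c t                       ∎) ⟩
  sum1 N (λ t → + δ M t ℤ.* + c t)
    ≡⟨ sum1-δ N M (λ t → + c t) 1≤M M≤N ⟩
  + c M ∎
  where open ≡-Reasoning

indicator : ℕ → ℕ → ℕ → ℕ
indicator s zero t = 0
indicator s (suc d) t = indicator s d t + δ (s + d) t

sum1-indicator-simpleRoots : ∀ N s d x → 1 ≤ s → s + d ≤ suc N →
  sum1 N (λ t → + indicator s d t ℤ.* simpleRoot t x) ≡ e s x ℤ.- e (s + d) x
sum1-indicator-simpleRoots N s zero x _ _ rewrite +-identityʳ s =
  trans (sum1-≡0 N _ (λ _ _ _ → refl)) (sym (ℤₚ.+-inverseʳ (e s x)))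
sum1-indicator-simpleRoots N s (suc d) x 1≤s s+d+1≤N+1 = begin
  sum1 N (λ t → + (indicator s d t + δ u t) ℤ.* simpleRoot t x)
    ≡⟨ sum1-cong N _ _ (λ t _ _ → trans (cong (ℤ._* simpleRoot t x) (ℤₚ.pos-+ (indicator s d t) (δ u t)))
                                    (ℤₚ.*-distribʳ-+ (simpleRoot t x) (+ indicator s d t) (+ δ u t))) ⟩
  sum1 N (λ t → + indicator s d t ℤ.* simpleRoot t x ℤ.+ + δ u t ℤ.* simpleRoot t x)
    ≡⟨ sum1-+ N _ _ ⟩
  sum1 N (λ t → + indicator s d t ℤ.* simpleRoot t x) ℤ.+ sum1 N (λ t → + δ u t ℤ.* simpleRoot t x)
    ≡⟨ cong₂ ℤ._+_ (sum1-indicator-simpleRoots N s d x 1≤s (≤-trans (n≤1+n _) u<N+1))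
                   (sum1-δ N u (λ t → simpleRoot t x) (≤-trans 1≤s (m≤m+n s d)) (≤-pred u<N+1)) ⟩
  (e s x ℤ.- e u x) ℤ.+ (e u x ℤ.- e (suc u) x)
    ≡⟨ lemma (e s x) (e u x) (e (suc u) x) ⟩
  e s x ℤ.- e (suc u) x
    ≡⟨ cong (λ z → e s x ℤ.- e z x) (sym (+-suc s d)) ⟩
  e s x ℤ.- e (s + suc d) x ∎
  where
  open ≡-Reasoning
  u : ℕ
  u = s + d
  u<N+1 : suc u ≤ suc N
  u<N+1 = subst (_≤ suc N) (+-suc s d) s+d+1≤N+1
  lemma : ∀ a b c → (a ℤ.- b) ℤ.+ (b ℤ.- c) ≡ a ℤ.- c
  lemma = ℤ-Solver.solve-∀

RootLeq-intro : ∀ N {i j k l} → 1 ≤ k → k ≤ i → i < j → j ≤ l → l ≤ suc N →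
  Σ (ℕ → ℕ) λ c → ∀ x → posRoot k l x ℤ.- posRoot i j x ≡ sum1 N (λ t → + c t ℤ.* simpleRoot t x)
RootLeq-intro N {i} {j} {k} {l} 1≤k k≤i i<j j≤l l≤N+1 = c , λ x → sym (begin
  sum1 N (λ t → + c t ℤ.* simpleRoot t x)
    ≡⟨ sum1-cong N _ _ (λ t _ _ → trans (cong (ℤ._* simpleRoot t x) (ℤₚ.pos-+ (lower t) (upper t)))
                                     (ℤₚ.*-distribʳ-+ (simpleRoot t x) (+ lower t) (+ upper t))) ⟩
  sum1 N (λ t → + lower t ℤ.* simpleRoot t x ℤ.+ + upper t ℤ.* simpleRoot t x)
    ≡⟨ sum1-+ N _ _ ⟩
  sum1 N (λ t → + lower t ℤ.* simpleRoot t x) ℤ.+ sum1 N (λ t → + upper t ℤ.* simpleRoot t x)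
    ≡⟨ cong₂ ℤ._+_
         (sum1-indicator-simpleRoots N k (i ∸ k) x 1≤k (subst (_≤ suc N) (sym (m+[n∸m]≡n k≤i)) i≤N+1))
         (sum1-indicator-simpleRoots N j (l ∸ j) x 1≤j (subst (_≤ suc N) (sym (m+[n∸m]≡n j≤l)) l≤N+1)) ⟩
  (e k x ℤ.- e (k + (i ∸ k)) x) ℤ.+ (e j x ℤ.- e (j + (l ∸ j)) x)
    ≡⟨ cong₂ (λ y z → (e k x ℤ.- e y x) ℤ.+ (e j x ℤ.- e z x)) (m+[n∸m]≡n k≤i) (m+[n∸m]≡n j≤l) ⟩
  (e k x ℤ.- e i x) ℤ.+ (e j x ℤ.- e l x)
    ≡⟨ lemma (e k x) (e l x) (e i x) (e j x) ⟩
  posRoot k l x ℤ.- posRoot i j x ∎)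
  where
  open ≡-Reasoning
  lower upper c : ℕ → ℕ
  lower = indicator k (i ∸ k)
  upper = indicator j (l ∸ j)
  c t = lower t + upper t
  i≤N+1 : i ≤ suc N
  i≤N+1 = <⇒≤ (<-≤-trans i<j (≤-trans j≤l l≤N+1))
  1≤j : 1 ≤ j
  1≤j = ≤-trans 1≤k (≤-trans k≤i (<⇒≤ i<j))
  lemma : ∀ a b c d → (a ℤ.- c) ℤ.+ (d ℤ.- b) ≡ (a ℤ.- b) ℤ.- (c ℤ.- d)
  lemma = ℤ-Solver.solve-∀

-- Summing the coordinates 1..M of both sides gives c M ≥ 0 on the right, but -1 on the left
-- for M = i when i < k, and for M = j - 1 when l < j.
RootLeq-elim : ∀ N {i j k l} → 1 ≤ i → i < j → j ≤ suc N → 1 ≤ k → k < l → l ≤ suc N →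
  (c : ℕ → ℕ) →
  (∀ x → posRoot k l x ℤ.- posRoot i j x ≡ sum1 N (λ t → + c t ℤ.* simpleRoot t x)) → k ≤ i × j ≤ l
RootLeq-elim N {i} {suc j'} {k} {l} 1≤i i<j j≤N+1 1≤k k<l l≤N+1 c difference≡combination = k≤i , j≤l
  where
  j : ℕ
  j = suc j'
  prefixSum : ∀ M → 1 ≤ M → M ≤ N → sum1 M (λ x → posRoot k l x ℤ.- posRoot i j x) ≡ + c M
  prefixSum M 1≤M M≤N =
    trans (sum1-cong M _ _ (λ x _ _ → difference≡combination x)) (prefixSum-simpleRoots M N c 1≤M M≤N)
  prefixSum-difference : ∀ M → sum1 M (λ x → posRoot k l x ℤ.- posRoot i j x) ≡
    (sum1 M (e k) ℤ.- sum1 M (e l)) ℤ.- (sum1 M (e i) ℤ.- sum1 M (e j))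
  prefixSum-difference M = trans (sum1-difference M (posRoot k l) (posRoot i j))
    (cong₂ ℤ._-_ (sum1-difference M (e k) (e l)) (sum1-difference M (e i) (e j)))
  +≢-1 : ∀ {a} → + a ≢ -[1+ 0 ]
  +≢-1 ()
  k≤i : k ≤ i
  k≤i with k ≤? i
  ... | yes k≤i = k≤i
  ... | no k≰i = ⊥-elim (+≢-1 (trans (sym (prefixSum i 1≤i (≤-pred (<-≤-trans i<j j≤N+1))))
                                      (trans (prefixSum-difference i) prefixSum≡-1)))
    where
    i<k : i < k
    i<k = ≰⇒> k≰i
    prefixSum≡-1 : (sum1 i (e k) ℤ.- sum1 i (e l)) ℤ.- (sum1 i (e i) ℤ.- sum1 i (e j)) ≡ -[1+ 0 ]
    prefixSum≡-1 rewrite sum1-e-> i k i<k | sum1-e-> i l (<-trans i<k k<l) | sum1-e-≤ i i 1≤i ≤-refl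
      | sum1-e-> i j i<j = refl
  j≤l : j ≤ l
  j≤l with j ≤? l
  ... | yes j≤l = j≤l
  ... | no j≰l = ⊥-elim (+≢-1 (trans (sym (prefixSum j' 1≤j' (≤-pred j≤N+1)))
                                      (trans (prefixSum-difference j') prefixSum≡-1)))
    where
    l≤j' : l ≤ j'
    l≤j' = ≤-pred (≰⇒> j≰l)
    1≤j' : 1 ≤ j'
    1≤j' = ≤-trans 1≤k (≤-trans (<⇒≤ k<l) l≤j')
    prefixSum≡-1 : (sum1 j' (e k) ℤ.- sum1 j' (e l)) ℤ.- (sum1 j' (e i) ℤ.- sum1 j' (e j)) ≡ -[1+ 0 ]
    prefixSum≡-1 rewrite sum1-e-≤ j' k 1≤k (≤-trans (<⇒≤ k<l) l≤j')
      | sum1-e-≤ j' l (≤-trans 1≤k (<⇒≤ k<l)) l≤j'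
      | sum1-e-≤ j' i 1≤i (≤-pred i<j) | sum1-e-> j' j ≤-refl = refl

pairs : ℕ → List (ℕ × ℕ)
pairs zero = []
pairs (suc b) = pairs b ++ map (_, suc b) (interval 1 b)

length-pairs : ∀ n → length (pairs n) ≡ n C 2
length-pairs zero = refl
length-pairs (suc b) = begin
  length (pairs b ++ map (_, suc b) (interval 1 b))
    ≡⟨ length-++ (pairs b) ⟩
  length (pairs b) + length (map (_, suc b) (interval 1 b))
    ≡⟨ cong₂ _+_ (length-pairs b) (trans (length-map _ (interval 1 b)) (length-interval 1 b)) ⟩
  b C 2 + b
    ≡⟨ +-comm (b C 2) b ⟩
  b + b C 2
    ≡⟨ cong (_+ b C 2) (sym (nC1≡n b)) ⟩
  b C 1 + b C 2
    ≡⟨ nCk+nC[k+1]≡[n+1]C[k+1] b 1 ⟩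
  suc b C 2 ∎
  where open ≡-Reasoning

∈-pairs⁻ : ∀ n {a b} → (a , b) ∈ pairs n → 1 ≤ a × a < b × b ≤ n
∈-pairs⁻ (suc n) p with ∈-++⁻ (pairs n) p
... | inj₁ q = let 1≤a , a<b , b≤n = ∈-pairs⁻ n q in 1≤a , a<b , m≤n⇒m≤1+n b≤n
... | inj₂ q with ∈-map⁻ (_, suc n) q
... | _ , a∈ , refl = proj₁ (∈-interval⁻ 1 n a∈) , proj₂ (∈-interval⁻ 1 n a∈) , ≤-refl

∈-pairs⁺ : ∀ n {a b} → 1 ≤ a → a < b → b ≤ n → (a , b) ∈ pairs n
∈-pairs⁺ zero 1≤a a<b b≤0 = ⊥-elim (<-irrefl refl (≤-trans (≤-trans 1≤a (<⇒≤ a<b)) b≤0))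
∈-pairs⁺ (suc n) 1≤a a<b b≤n+1 with m≤n⇒m<n∨m≡n b≤n+1
... | inj₁ b<n+1 = ∈-++⁺ˡ (∈-pairs⁺ n 1≤a a<b (≤-pred b<n+1))
... | inj₂ refl = ∈-++⁺ʳ (pairs n) (∈-map⁺ (_, suc n) (∈-interval⁺ 1 n 1≤a a<b))

pairs-unique : ∀ n → Unique (pairs n)
pairs-unique zero = []
pairs-unique (suc n) = Unique.++⁺ (pairs-unique n)
  (Unique.map⁺ (cong proj₁) (Increasing⇒Unique (interval-increasing 1 n))) disjoint
  where
  disjoint : ∀ {v} → ¬ (v ∈ pairs n × v ∈ map (_, suc n) (interval 1 n))
  disjoint {a , b} (p , q) with ∈-map⁻ (_, suc n) q
  ... | _ , _ , refl = <-irrefl refl (proj₂ (proj₂ (∈-pairs⁻ n p)))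

zip-++ : ∀ {A B : Set} (xs : List A) (ys : List B) xs' ys' → length xs ≡ length ys →
  zip (xs ++ xs') (ys ++ ys') ≡ zip xs ys ++ zip xs' ys'
zip-++ [] [] xs' ys' _ = refl
zip-++ (x ∷ xs) (y ∷ ys) xs' ys' |xs|≡|ys| = cong ((x , y) ∷_) (zip-++ xs ys xs' ys' (suc-injective |xs|≡|ys|))

length-∷-++-∷ : ∀ {A : Set} (x : A) xs y → length (x ∷ xs ++ y ∷ []) ≡ suc (suc (length xs))
length-∷-++-∷ x xs y = cong suc (trans (length-++ xs) (+-comm (length xs) 1))

∈-between⁻ : ∀ {A : Set} {p h t : A} xs → p ∈ h ∷ xs ++ t ∷ [] → p ≡ h ⊎ p ∈ xs ⊎ p ≡ t
∈-between⁻ xs (here p≡h) = inj₁ p≡h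
∈-between⁻ xs (there q) with ∈-++⁻ xs q
... | inj₁ p∈xs = inj₂ (inj₁ p∈xs)
... | inj₂ (here p≡t) = inj₂ (inj₂ p≡t)

rowCells-single : ∀ r x → rowCells r (x + 1) x ≡ (r , x + 1) ∷ []
rowCells-single r x rewrite m+n∸m≡n x 1 = refl

module Lobster (m : ℕ) where

  n : ℕ
  n = suc (suc (suc m))

  bodyCells : List Cell
  bodyCells = map (2 ,_) (interval 2 (suc m))

  Cells : List Cell
  Cells = (1 , n) ∷ bodyCells ++ (3 , n) ∷ []

  L11≡Cells : L11 n ≡ Cells
  L11≡Cells rewrite rowCells-single 1 (suc m + 1) | rowCells-single 3 (suc m + 1) =
    cong₂ (λ c body → (1 , c) ∷ body ++ (3 , c) ∷ []) clawColumn bodyRow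
    where
    clawColumn : suc m + 1 + 1 ≡ n
    clawColumn = cong suc (trans (+-assoc m 1 1) (+-comm m 2))
    bodyRow : rowCells 2 (suc m + 1) 1 ≡ bodyCells
    bodyRow = begin
      map (λ k → (2 , 2 + k)) (upTo (m + 1))
        ≡⟨ map-applyUpTo id _ (m + 1) ⟩
      applyUpTo (λ k → (2 , 2 + k)) (m + 1)
        ≡⟨ sym (map-applyUpTo (suc ∘ suc) (2 ,_) (m + 1)) ⟩
      map (2 ,_) (applyUpTo (suc ∘ suc) (m + 1))
        ≡⟨ cong (map (2 ,_)) (applyUpTo-interval (suc ∘ suc) 2 (m + 1) (λ _ → refl)) ⟩
      map (2 ,_) (interval 2 (m + 1))
        ≡⟨ cong (map (2 ,_) ∘ interval 2) (+-comm m 1) ⟩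
      bodyCells ∎
      where open ≡-Reasoning

  length-bodyCells : length bodyCells ≡ suc m
  length-bodyCells = trans (length-map {B = Cell} (2 ,_) (interval 2 (suc m))) (length-interval 2 (suc m))

  length-Cells : length Cells ≡ n
  length-Cells = cong suc (begin
    length (bodyCells ++ (3 , n) ∷ [])  ≡⟨ length-++ bodyCells ⟩
    length bodyCells + 1               ≡⟨ cong (_+ 1) length-bodyCells ⟩
    suc m + 1                          ≡⟨ +-comm (suc m) 1 ⟩
    suc (suc m)                        ∎)
    where open ≡-Reasoning

  Admissible : ℕ → ℕ → Set
  Admissible a b = 1 ≤ a × a < b × b ≤ n

  Other : ℕ → ℕ → ℕ → Set
  Other a b v = v ≢ a × v ≢ b

  other? : ∀ a b → Decidable (Other a b)
  other? a b v = ¬? (v ≟ a) ×-dec ¬? (v ≟ b)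

  body : ℕ → ℕ → List ℕ
  body a b = filter (other? a b) (interval 1 n)

  fill : ℕ → ℕ → Filling
  fill a b = a ∷ body a b ++ b ∷ []

  bottomClaw : Filling → ℕ
  bottomClaw [] = 0
  bottomClaw (a ∷ _) = a

  topClaw : Filling → ℕ
  topClaw [] = 0
  topClaw (b ∷ []) = b
  topClaw (_ ∷ b ∷ T) = topClaw (b ∷ T)

  topClaw-∷ʳ : ∀ a B b → topClaw (a ∷ B ++ b ∷ []) ≡ b
  topClaw-∷ʳ a [] b = refl
  topClaw-∷ʳ a (x ∷ B) b = topClaw-∷ʳ x B b

  topClaw-fill : ∀ a b → topClaw (fill a b) ≡ b
  topClaw-fill a b = topClaw-∷ʳ a (body a b) b

  fill-injective : ∀ {p q} → uncurry fill p ≡ uncurry fill q → p ≡ q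
  fill-injective {a , b} {a' , b'} eq =
    cong₂ _,_ (cong bottomClaw eq) (trans (sym (topClaw-fill a b)) (trans (cong topClaw eq) (topClaw-fill a' b')))

  body⊆interval : ∀ a b {v} → v ∈ body a b → v ∈ interval 1 n
  body⊆interval a b = proj₁ ∘ ∈-filter⁻ (other? a b) {xs = interval 1 n}

  ∈-body⁻ : ∀ a b {v} → v ∈ body a b → (1 ≤ v × v ≤ n) × Other a b v
  ∈-body⁻ a b v∈ with ∈-interval⁻ 1 n (body⊆interval a b v∈)
  ... | 1≤v , v<n+1 = (1≤v , ≤-pred v<n+1) , proj₂ (∈-filter⁻ (other? a b) {xs = interval 1 n} v∈)

  ∈-body⁺ : ∀ {a b v} → 1 ≤ v → v ≤ n → Other a b v → v ∈ body a b
  ∈-body⁺ {a} {b} 1≤v v≤n = ∈-filter⁺ (other? a b) (∈-interval⁺ 1 n 1≤v (s≤s v≤n))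

  body-increasing : ∀ a b → Increasing (body a b)
  body-increasing a b = AllPairs.filter⁺ (other? a b) (interval-increasing 1 n)

  fill-unique : ∀ {a b} → Admissible a b → Unique (fill a b)
  fill-unique {a} {b} (_ , a<b , _) =
    All.tabulate a≢ ∷ Unique.++⁺ (Increasing⇒Unique (body-increasing a b)) ([] ∷ [])
                        (λ { (v∈ , here refl) → proj₂ (proj₂ (∈-body⁻ a b v∈)) refl })
    where
    a≢ : ∀ {z} → z ∈ body a b ++ b ∷ [] → a ≢ z
    a≢ z∈ with ∈-++⁻ (body a b) z∈
    ... | inj₁ z∈body = proj₁ (proj₂ (∈-body⁻ a b z∈body)) ∘ sym
    ... | inj₂ (here refl) = <⇒≢ a<b

  ∈-fill⇔ : ∀ {a b} → Admissible a b → ∀ {z} → z ∈ fill a b ⇔ z ∈ interval 1 n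
  ∈-fill⇔ {a} {b} (1≤a , a<b , b≤n) {z} = mk⇔ to from
    where
    to : z ∈ fill a b → z ∈ interval 1 n
    to (here refl) = ∈-interval⁺ 1 n 1≤a (s≤s (<⇒≤ (<-≤-trans a<b b≤n)))
    to (there z∈) with ∈-++⁻ (body a b) z∈
    ... | inj₁ z∈body = body⊆interval a b z∈body
    ... | inj₂ (here refl) = ∈-interval⁺ 1 n (≤-trans 1≤a (<⇒≤ a<b)) (s≤s b≤n)
    from : z ∈ interval 1 n → z ∈ fill a b
    from z∈ with ∈-interval⁻ 1 n z∈ | z ≟ a | z ≟ b
    ... | _ | yes refl | _ = here refl
    ... | _ | no _ | yes refl = there (∈-++⁺ʳ (body a b) (here refl))
    ... | 1≤z , z<n+1 | no z≢a | no z≢b = there (∈-++⁺ˡ (∈-body⁺ 1≤z (≤-pred z<n+1) (z≢a , z≢b)))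

  fill-↭ : ∀ {a b} → Admissible a b → fill a b ↭ interval 1 n
  fill-↭ adm = unique-⇔⇒↭ (fill-unique adm) (Increasing⇒Unique (interval-increasing 1 n)) (∈-fill⇔ adm)

  length-body : ∀ {a b} → Admissible a b → length (body a b) ≡ suc m
  length-body {a} {b} adm = suc-injective (suc-injective
    (trans (sym (length-∷-++-∷ a (body a b) b)) (trans (↭-length (fill-↭ adm)) (length-interval 1 n))))

  zip-Cells : ∀ a B b → length B ≡ suc m →
    zip Cells (a ∷ B ++ b ∷ []) ≡ ((1 , n) , a) ∷ rowFilling 2 2 B ++ ((3 , n) , b) ∷ []
  zip-Cells a B b |B|≡m+1 = cong (((1 , n) , a) ∷_) (trans
    (zip-++ bodyCells B _ _ (trans length-bodyCells (sym |B|≡m+1)))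
    (cong (_++ _) (subst (λ l → zip (map (2 ,_) (interval 2 l)) B ≡ rowFilling 2 2 B) |B|≡m+1
                    (zip-interval-rowFilling 2 2 B))))

  zip-fill : ∀ {a b} → Admissible a b →
    zip Cells (fill a b) ≡ ((1 , n) , a) ∷ rowFilling 2 2 (body a b) ++ ((3 , n) , b) ∷ []
  zip-fill {a} {b} adm = zip-Cells a (body a b) b (length-body adm)

  ∈-zip-fill⁻ : ∀ {a b p} → Admissible a b → p ∈ zip Cells (fill a b) →
    p ≡ ((1 , n) , a) ⊎ p ∈ rowFilling 2 2 (body a b) ⊎ p ≡ ((3 , n) , b)
  ∈-zip-fill⁻ {a} {b} {p} adm p∈ = ∈-between⁻ (rowFilling 2 2 (body a b)) (subst (p ∈_) (zip-fill adm) p∈)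

  ∈-bodyRow⁻ : ∀ {a b r c x} → Admissible a b → ((r , c) , x) ∈ rowFilling 2 2 (body a b) → r ≡ 2 × c < n
  ∈-bodyRow⁻ {a} {b} adm p∈ with ∈-rowFilling⁻ 2 2 (body a b) p∈
  ... | r≡2 , (_ , c<2+l) , _ = r≡2 , subst (λ l → _ < 2 + l) (length-body adm) c<2+l

  fill-isSET : ∀ {a b} → Admissible a b → IsSET Cells (fill a b)
  fill-isSET {a} {b} adm@(_ , a<b , _) = record
    { sameLength = trans (↭-length (fill-↭ adm)) (trans (length-interval 1 n) (sym length-Cells))
    ; bijective = subst (fill a b ↭_) (sym (trans (cong (map suc ∘ upTo) length-Cells) (map-suc-upTo n))) (fill-↭ adm)
    ; rowInc = rowInc
    ; colInc = colInc
    }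
    where
    rowInc : ∀ {r c c' x y} → ((r , c) , x) ∈ zip Cells (fill a b) → ((r , c') , y) ∈ zip Cells (fill a b) →
             c < c' → x < y
    rowInc p q c<c' with ∈-zip-fill⁻ adm p | ∈-zip-fill⁻ adm q
    ... | inj₂ (inj₁ p∈) | inj₂ (inj₁ q∈) = rowFilling-increasing 2 2 (body a b) (body-increasing a b) p∈ q∈ c<c'
    ... | inj₁ refl | inj₁ refl = ⊥-elim (<-irrefl refl c<c')
    ... | inj₂ (inj₂ refl) | inj₂ (inj₂ refl) = ⊥-elim (<-irrefl refl c<c')
    ... | inj₁ refl | inj₂ (inj₁ q∈) = case proj₁ (∈-bodyRow⁻ adm q∈) of λ ()
    ... | inj₂ (inj₁ p∈) | inj₁ refl = case proj₁ (∈-bodyRow⁻ adm p∈) of λ ()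
    ... | inj₂ (inj₁ p∈) | inj₂ (inj₂ refl) = case proj₁ (∈-bodyRow⁻ adm p∈) of λ ()
    ... | inj₂ (inj₂ refl) | inj₂ (inj₁ q∈) = case proj₁ (∈-bodyRow⁻ adm q∈) of λ ()
    colInc : ∀ {r r' c x y} → ((r , c) , x) ∈ zip Cells (fill a b) → ((r' , c) , y) ∈ zip Cells (fill a b) →
             r < r' → x < y
    colInc p q r<r' with ∈-zip-fill⁻ adm p | ∈-zip-fill⁻ adm q
    ... | inj₁ refl | inj₂ (inj₂ refl) = a<b
    ... | inj₁ refl | inj₁ refl = ⊥-elim (<-irrefl refl r<r')
    ... | inj₂ (inj₂ refl) | inj₂ (inj₂ refl) = ⊥-elim (<-irrefl refl r<r')
    ... | inj₂ (inj₂ refl) | inj₁ refl = case r<r' of λ { (s≤s ()) }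
    ... | inj₂ (inj₁ p∈) | inj₂ (inj₁ q∈) rewrite proj₁ (∈-bodyRow⁻ adm p∈) | proj₁ (∈-bodyRow⁻ adm q∈) =
      ⊥-elim (<-irrefl refl r<r')
    ... | inj₂ (inj₁ p∈) | inj₁ refl = ⊥-elim (<-irrefl refl (proj₂ (∈-bodyRow⁻ adm p∈)))
    ... | inj₂ (inj₁ p∈) | inj₂ (inj₂ refl) = ⊥-elim (<-irrefl refl (proj₂ (∈-bodyRow⁻ adm p∈)))
    ... | inj₁ refl | inj₂ (inj₁ q∈) = ⊥-elim (<-irrefl refl (proj₂ (∈-bodyRow⁻ adm q∈)))
    ... | inj₂ (inj₂ refl) | inj₂ (inj₁ q∈) = ⊥-elim (<-irrefl refl (proj₂ (∈-bodyRow⁻ adm q∈)))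

  isSET⇒body : ∀ {a B b} → IsSET Cells (a ∷ B ++ b ∷ []) → Admissible a b × B ≡ body a b
  isSET⇒body {a} {B} {b} T-SET =
    (1≤a , a<b , b≤n) , increasing-⇔⇒≡ B-increasing (body-increasing a b) (mk⇔ B⊆body body⊆B)
    where
    open IsSET T-SET
    T : Filling
    T = a ∷ B ++ b ∷ []
    inZip : ∀ {p} → p ∈ ((1 , n) , a) ∷ rowFilling 2 2 B ++ ((3 , n) , b) ∷ [] → p ∈ zip Cells T
    inZip {p} = subst (p ∈_) (sym (zip-Cells a B b (suc-injective (suc-injective
      (trans (sym (length-∷-++-∷ a B b)) (trans sameLength length-Cells))))))
    B-increasing : Increasing B
    B-increasing =
      rowFilling-increasing⁻ 2 2 B (λ p q → rowInc (inZip (there (∈-++⁺ˡ p))) (inZip (there (∈-++⁺ˡ q))))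
    a<b : a < b
    a<b = colInc (inZip (here refl)) (inZip (there (∈-++⁺ʳ _ (here refl)))) (s≤s (s≤s z≤n))
    T↭ : T ↭ interval 1 n
    T↭ = subst (T ↭_) (trans (cong (map suc ∘ upTo) length-Cells) (map-suc-upTo n)) bijective
    inRange : ∀ {z} → z ∈ T → 1 ≤ z × z ≤ n
    inRange z∈ = let 1≤z , z<n+1 = ∈-interval⁻ 1 n (∈-resp-↭ T↭ z∈) in 1≤z , ≤-pred z<n+1
    1≤a : 1 ≤ a
    1≤a = proj₁ (inRange (here refl))
    b≤n : b ≤ n
    b≤n = proj₂ (inRange (there (∈-++⁺ʳ B (here refl))))
    B⊆body : ∀ {z} → z ∈ B → z ∈ body a b
    B⊆body {z} z∈B with unique-resp-↭ (↭-sym T↭) (Increasing⇒Unique (interval-increasing 1 n))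
    ... | a≢ ∷ B∷ʳb-unique = let 1≤z , z≤N = inRange (there (∈-++⁺ˡ z∈B)) in
      ∈-body⁺ 1≤z z≤N ((All.lookup a≢ (∈-++⁺ˡ z∈B) ∘ sym) , (λ { refl → unique-∷ʳ⇒∉ B B∷ʳb-unique z∈B }))
    body⊆B : ∀ {z} → z ∈ body a b → z ∈ B
    body⊆B z∈body with ∈-resp-↭ (↭-sym T↭) (body⊆interval a b z∈body)
    ... | here z≡a = ⊥-elim (proj₁ (proj₂ (∈-body⁻ a b z∈body)) z≡a)
    ... | there z∈ with ∈-++⁻ B z∈
    ...   | inj₁ z∈B = z∈B
    ...   | inj₂ (here z≡b) = ⊥-elim (proj₂ (proj₂ (∈-body⁻ a b z∈body)) z≡b)

  isSET⇒fill : ∀ {T} → IsSET Cells T → Admissible (bottomClaw T) (topClaw T) × T ≡ fill (bottomClaw T) (topClaw T)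
  isSET⇒fill {[]} T-SET = case trans (IsSET.sameLength T-SET) length-Cells of λ ()
  isSET⇒fill {a ∷ T'} T-SET with initLast T'
  ... | [] = case trans (IsSET.sameLength T-SET) length-Cells of λ ()
  ... | B ∷ʳ′ b rewrite topClaw-∷ʳ a B b =
    let adm , B≡body = isSET⇒body T-SET in adm , cong (λ X → a ∷ X ++ b ∷ []) B≡body

  -- The operators π_i

  data Place (a b v : ℕ) : Set where
    bottom : v ≡ a → Place a b v
    top : v ≡ b → Place a b v
    inBody : Other a b v → Place a b v

  place : ∀ a b v → Place a b v
  place a b v with v ≟ a | v ≟ b
  ... | yes v≡a | _ = bottom v≡a
  ... | no _ | yes v≡b = top v≡b
  ... | no v≢a | no v≢b = inBody (v≢a , v≢b)

  rowOfPlace : ∀ {a b v} → Place a b v → ℕ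
  rowOfPlace (bottom _) = 1
  rowOfPlace (top _) = 3
  rowOfPlace (inBody _) = 2

  rowOf-fill : ∀ {a b v} → Admissible a b → 1 ≤ v → v ≤ n → (pl : Place a b v) →
    rowOf (zip Cells (fill a b)) v ≡ just (rowOfPlace pl)
  rowOf-fill {a} {b} {v} adm@(_ , a<b , _) 1≤v v≤n pl = trans (cong (λ l → rowOf l v) (zip-fill adm)) (row pl)
    where
    rest : List (Cell × ℕ)
    rest = rowFilling 2 2 (body a b) ++ ((3 , n) , b) ∷ []
    row : (pl : Place a b v) → rowOf (((1 , n) , a) ∷ rest) v ≡ just (rowOfPlace pl)
    row (bottom refl) rewrite ≡ᵇ-refl a = refl
    row (top refl) rewrite ≢⇒≡ᵇ-false (<⇒≢ a<b)
      | rowOf-rowFilling-∉ 2 2 (body a b) (((3 , n) , b) ∷ []) (λ b∈ → proj₂ (proj₂ (∈-body⁻ a b b∈)) refl)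
      | ≡ᵇ-refl b = refl
    row (inBody other@(v≢a , _)) rewrite ≢⇒≡ᵇ-false (v≢a ∘ sym) =
      rowOf-rowFilling-∈ 2 2 (body a b) _ (∈-body⁺ 1≤v v≤n other)

  πByRows : ℕ → ℕ → ℕ → Filling → Maybe Filling
  πByRows r r' i T = if r <ᵇ r' then just T else (if r' <ᵇ r then just (map (swapVal i) T) else nothing)

  π-by-rows : ∀ cs i T r r' → rowOf (zip cs T) i ≡ just r → rowOf (zip cs T) (suc i) ≡ just r' →
    π cs i T ≡ πByRows r r' i T
  π-by-rows cs i T r r' row-i row-i+1 with rowOf (zip cs T) i | rowOf (zip cs T) (suc i)
  π-by-rows cs i T r r' refl refl | just .r | just .r' = refl

  π-fill : ∀ {a b i} → Admissible a b → 1 ≤ i → i < n → (p : Place a b i) (q : Place a b (suc i)) →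
    π Cells i (fill a b) ≡ πByRows (rowOfPlace p) (rowOfPlace q) i (fill a b)
  π-fill adm 1≤i i<n p q =
    π-by-rows Cells _ (fill _ _) _ _ (rowOf-fill adm 1≤i (<⇒≤ i<n) p) (rowOf-fill adm (s≤s z≤n) i<n q)

  map-swapVal-fill-top : ∀ {a b} → Admissible a b → suc b ≤ n → map (swapVal b) (fill a b) ≡ fill a (suc b)
  map-swapVal-fill-top {a} {b} (1≤a , a<b , _) b<n = begin
    map (swapVal b) (fill a b)
      ≡⟨ cong (swapVal b a ∷_) (map-++ (swapVal b) (body a b) (b ∷ [])) ⟩
    swapVal b a ∷ map (swapVal b) (body a b) ++ swapVal b b ∷ []
      ≡⟨ cong₂ (λ x B → x ∷ B ++ swapVal b b ∷ [])
           (swapVal-other (<⇒≢ a<b) (<⇒≢ (m<n⇒m<1+n a<b))) body-swap ⟩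
    a ∷ body a (suc b) ++ swapVal b b ∷ []
      ≡⟨ cong (λ x → a ∷ body a (suc b) ++ x ∷ []) (swapVal-self b) ⟩
    fill a (suc b) ∎
    where
    open ≡-Reasoning
    body-swap : map (swapVal b) (body a b) ≡ body a (suc b)
    body-swap = map-swapVal-filter-interval (other? a b) (other? a (suc b)) b
      (λ v≢b v≢b+1 → mk⇔ (λ (v≢a , _) → v≢a , v≢b) (λ (v≢a , _) → v≢a , v≢b+1))
      1 n (≤-trans 1≤a (<⇒≤ a<b)) (s≤s b<n)
      (mk⇔ (λ _ → (<⇒≢ (m<n⇒m<1+n a<b) ∘ sym) , 1+n≢n) (λ _ → (<⇒≢ a<b ∘ sym) , (1+n≢n ∘ sym)))
      (mk⇔ (λ (_ , b+1≢b+1) → ⊥-elim (b+1≢b+1 refl)) (λ (_ , b≢b) → ⊥-elim (b≢b refl)))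
      (λ ((_ , b≢b) , _) → b≢b refl)

  map-swapVal-fill-bottom : ∀ {c b} → 1 ≤ c → Admissible (suc c) b → map (swapVal c) (fill (suc c) b) ≡ fill c b
  map-swapVal-fill-bottom {c} {b} 1≤c (_ , c+1<b , b≤n) = begin
    map (swapVal c) (fill (suc c) b)
      ≡⟨ cong (swapVal c (suc c) ∷_) (map-++ (swapVal c) (body (suc c) b) (b ∷ [])) ⟩
    swapVal c (suc c) ∷ map (swapVal c) (body (suc c) b) ++ swapVal c b ∷ []
      ≡⟨ cong₂ (λ x B → x ∷ B ++ swapVal c b ∷ []) (swapVal-suc c) body-swap ⟩
    c ∷ body c b ++ swapVal c b ∷ []
      ≡⟨ cong (λ x → c ∷ body c b ++ x ∷ [])
           (swapVal-other (<⇒≢ (<-trans (n<1+n c) c+1<b) ∘ sym) (<⇒≢ c+1<b ∘ sym)) ⟩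
    fill c b ∎
    where
    open ≡-Reasoning
    body-swap : map (swapVal c) (body (suc c) b) ≡ body c b
    body-swap = map-swapVal-filter-interval (other? (suc c) b) (other? c b) c
      (λ v≢c v≢c+1 → mk⇔ (λ (_ , v≢b) → v≢c+1 , v≢b) (λ (_ , v≢b) → v≢c , v≢b))
      1 n 1≤c (s≤s (≤-trans (<⇒≤ c+1<b) b≤n))
      (mk⇔ (λ (c≢c , _) → ⊥-elim (c≢c refl)) (λ (c+1≢c+1 , _) → ⊥-elim (c+1≢c+1 refl)))
      (mk⇔ (λ _ → (1+n≢n ∘ sym) , (<⇒≢ (<-trans (n<1+n c) c+1<b))) (λ _ → 1+n≢n , (<⇒≢ c+1<b)))
      (λ (_ , (c+1≢c+1 , _)) → c+1≢c+1 refl)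

  step-topClaw-up : ∀ {a b} → Admissible a b → suc b ≤ n → Step Cells (fill a b) (fill a (suc b))
  step-topClaw-up {a} {b} adm@(1≤a , a<b , _) b<n =
    b , ≤-trans 1≤a (<⇒≤ a<b) , subst (b <_) (sym length-Cells) b<n ,
    trans (π-fill adm (≤-trans 1≤a (<⇒≤ a<b)) b<n (top refl)
             (inBody ((<⇒≢ (m<n⇒m<1+n a<b) ∘ sym) , 1+n≢n)))
          (cong just (map-swapVal-fill-top adm b<n))

  step-bottomClaw-down : ∀ {c b} → 1 ≤ c → Admissible (suc c) b → Step Cells (fill (suc c) b) (fill c b)
  step-bottomClaw-down {c} {b} 1≤c adm@(_ , c+1<b , b≤n) =
    c , 1≤c , subst (c <_) (sym length-Cells) c<n ,
    trans (π-fill adm 1≤c c<n (inBody ((1+n≢n ∘ sym) , <⇒≢ (<-trans (n<1+n c) c+1<b))) (bottom refl))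
          (cong just (map-swapVal-fill-bottom 1≤c adm))
    where
    c<n : c < n
    c<n = <-trans (n<1+n c) (<-≤-trans c+1<b b≤n)

  FillAbove : ℕ → ℕ → Filling → Set
  FillAbove a b X = Σ ℕ λ a' → Σ ℕ λ b' → Admissible a' b' × a' ≤ a × b ≤ b' × X ≡ fill a' b'

  step-fill⁻ : ∀ {a b X} → Admissible a b → Step Cells (fill a b) X → FillAbove a b X
  step-fill⁻ {a} {b} {X} adm@(1≤a , a<b , b≤n) (i , 1≤i , i<|Cells| , π≡X) =
    by-places (place a b i) (place a b (suc i))
    where
    i<n : i < n
    i<n = subst (i <_) length-Cells i<|Cells|
    π-result : (p : Place a b i) (q : Place a b (suc i)) → πByRows (rowOfPlace p) (rowOfPlace q) i (fill a b) ≡ just X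
    π-result p q = trans (sym (π-fill adm 1≤i i<n p q)) π≡X
    unchanged : just (fill a b) ≡ just X → FillAbove a b X
    unchanged eq = a , b , adm , ≤-refl , ≤-refl , sym (just-injective eq)
    by-places : Place a b i → Place a b (suc i) → FillAbove a b X
    by-places (bottom refl) (bottom i+1≡i) = ⊥-elim (1+n≢n i+1≡i)
    by-places (top refl) (top i+1≡i) = ⊥-elim (1+n≢n i+1≡i)
    by-places (top refl) (bottom b+1≡a) = ⊥-elim (<-asym a<b (subst (b <_) b+1≡a (n<1+n b)))
    by-places p@(bottom refl) q@(top _) = unchanged (π-result p q)
    by-places p@(bottom refl) q@(inBody _) = unchanged (π-result p q)
    by-places p@(inBody _) q@(top _) = unchanged (π-result p q)
    by-places p@(inBody _) q@(inBody _) = case π-result p q of λ ()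
    by-places p@(top refl) q@(inBody _) = a , suc b , (1≤a , m<n⇒m<1+n a<b , i<n) , ≤-refl , n≤1+n b ,
      trans (sym (just-injective (π-result p q))) (map-swapVal-fill-top adm i<n)
    by-places p@(inBody _) q@(bottom refl) = i , b , (1≤i , <-trans (n<1+n i) a<b , b≤n) , n≤1+n i , ≤-refl ,
      trans (sym (just-injective (π-result p q))) (map-swapVal-fill-bottom 1≤i adm)

  star-fill⁻ : ∀ {a b X} → Admissible a b → Star (Step Cells) (fill a b) X → FillAbove a b X
  star-fill⁻ adm ε = _ , _ , adm , ≤-refl , ≤-refl , refl
  star-fill⁻ adm (step ◅ steps) with step-fill⁻ adm step
  ... | a₁ , b₁ , adm₁ , a₁≤a , b≤b₁ , refl with star-fill⁻ adm₁ steps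
  ...   | a₂ , b₂ , adm₂ , a₂≤a₁ , b₁≤b₂ , X≡ =
    a₂ , b₂ , adm₂ , ≤-trans a₂≤a₁ a₁≤a , ≤-trans b≤b₁ b₁≤b₂ , X≡

  star-topClaw-up : ∀ {a b} d → Admissible a b → b + d ≤ n → Star (Step Cells) (fill a b) (fill a (b + d))
  star-topClaw-up {a} {b} zero _ _ rewrite +-identityʳ b = ε
  star-topClaw-up {a} {b} (suc d) adm@(1≤a , a<b , _) b+d+1≤n rewrite +-suc b d =
    step-topClaw-up adm b<n ◅ star-topClaw-up d (1≤a , m<n⇒m<1+n a<b , b<n) b+d+1≤n
    where
    b<n : suc b ≤ n
    b<n = ≤-trans (s≤s (m≤m+n b d)) b+d+1≤n

  star-bottomClaw-down : ∀ {a b} d → 1 ≤ a → Admissible (a + d) b → Star (Step Cells) (fill (a + d) b) (fill a b)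
  star-bottomClaw-down {a} zero _ _ rewrite +-identityʳ a = ε
  star-bottomClaw-down {a} {b} (suc d) 1≤a adm = subst (λ z → Star (Step Cells) (fill z b) (fill a b)) (sym (+-suc a d))
    (step-bottomClaw-down 1≤a+d adm' ◅ star-bottomClaw-down d 1≤a (1≤a+d , <-trans (n<1+n _) a+d+1<b , b≤n))
    where
    adm' : Admissible (suc (a + d)) b
    adm' = subst (λ z → Admissible z b) (+-suc a d) adm
    a+d+1<b : suc (a + d) < b
    a+d+1<b = proj₁ (proj₂ adm')
    b≤n : b ≤ n
    b≤n = proj₂ (proj₂ adm')
    1≤a+d : 1 ≤ a + d
    1≤a+d = ≤-trans 1≤a (m≤m+n a d)

  star-fill⁺ : ∀ {a b a' b'} → Admissible a b → Admissible a' b' → a' ≤ a → b ≤ b' →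
    Star (Step Cells) (fill a b) (fill a' b')
  star-fill⁺ {a} {b} {a'} {b'} adm@(1≤a , a<b , _) (1≤a' , _ , b'≤n) a'≤a b≤b' =
    subst (Star (Step Cells) (fill a b) ∘ fill a) (m+[n∸m]≡n b≤b')
      (star-topClaw-up (b' ∸ b) adm (subst (_≤ n) (sym (m+[n∸m]≡n b≤b')) b'≤n))
    ◅◅ subst (λ z → Star (Step Cells) (fill z b') (fill a' b')) (m+[n∸m]≡n a'≤a)
      (star-bottomClaw-down (a ∸ a') 1≤a'
        (subst (λ z → Admissible z b') (sym (m+[n∸m]≡n a'≤a)) (1≤a , <-≤-trans a<b b≤b' , b'≤n)))

  -- The order and the two isomorphisms

  bottomOf topOf : SET (L11 n) → ℕ
  bottomOf S = bottomClaw (proj₁ S)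
  topOf S = topClaw (proj₁ S)

  L11-isSET⇒fill : ∀ (S : SET (L11 n)) → Admissible (bottomOf S) (topOf S) × proj₁ S ≡ fill (bottomOf S) (topOf S)
  L11-isSET⇒fill (T , T-SET) = isSET⇒fill (subst (λ cs → IsSET cs T) L11≡Cells T-SET)

  admissible : ∀ S → Admissible (bottomOf S) (topOf S)
  admissible S = proj₁ (L11-isSET⇒fill S)

  ≡fill : ∀ S → proj₁ S ≡ fill (bottomOf S) (topOf S)
  ≡fill S = proj₂ (L11-isSET⇒fill S)

  fillSET : ∀ {a b} → Admissible a b → SET (L11 n)
  fillSET {a} {b} adm = fill a b , subst (λ cs → IsSET cs (fill a b)) (sym L11≡Cells) (fill-isSET adm)

  ≤SET⇔ : ∀ S T → _≤SET_ {L11 n} S T ⇔ (bottomOf T ≤ bottomOf S × topOf S ≤ topOf T)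
  ≤SET⇔ S T = mk⇔ to from
    where
    to : _≤SET_ {L11 n} S T → bottomOf T ≤ bottomOf S × topOf S ≤ topOf T
    to S≤T with star-fill⁻ (admissible S)
                  (subst (λ X → Star (Step Cells) X (proj₁ T)) (≡fill S)
                    (subst (λ cs → Star (Step cs) (proj₁ S) (proj₁ T)) L11≡Cells S≤T))
    ... | a' , b' , _ , a'≤a , b≤b' , T≡fill =
      subst (_≤ bottomOf S) (sym (cong bottomClaw T≡fill)) a'≤a ,
      subst (topOf S ≤_) (sym (trans (cong topClaw T≡fill) (topClaw-fill a' b'))) b≤b'
    from : bottomOf T ≤ bottomOf S × topOf S ≤ topOf T → _≤SET_ {L11 n} S T
    from (a'≤a , b≤b') = subst (λ cs → Star (Step cs) (proj₁ S) (proj₁ T)) (sym L11≡Cells)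
      (subst₂ (Star (Step Cells)) (sym (≡fill S)) (sym (≡fill T))
        (star-fill⁺ (admissible S) (admissible T) a'≤a b≤b'))

  SET≅Root : PosetIso {SET (L11 n)} {Root n} (_≈SET_ {L11 n}) (_≤SET_ {L11 n}) (_≈R_ {n}) (RootLeq n)
  SET≅Root = record
    { to = λ S → (bottomOf S , topOf S) , admissible S
    ; from = λ r → fillSET (proj₂ r)
    ; to-cong = λ _ _ S≡S' → cong (λ T → bottomClaw T , topClaw T) S≡S'
    ; from-cong = λ _ _ r≡r' → cong (λ (a , b) → fill a b) r≡r'
    ; from∘to = λ S → sym (≡fill S)
    ; to∘from = λ { ((a , b) , _) → cong (a ,_) (topClaw-fill a b) }
    ; monotone = λ S T S≤T →
        let a'≤a , b≤b' = Equivalence.to (≤SET⇔ S T) S≤T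
            1≤a' , _ , b'≤n = admissible T
            _ , a<b , _ = admissible S in
        RootLeq-intro (suc (suc m)) 1≤a' a'≤a a<b b≤b' b'≤n
    ; reflects = λ S T (c , difference≡combination) →
        let 1≤a , a<b , b≤n = admissible S
            1≤a' , a'<b' , b'≤n = admissible T in
        Equivalence.from (≤SET⇔ S T)
          (RootLeq-elim (suc (suc m)) 1≤a a<b b≤n 1≤a' a'<b' b'≤n c difference≡combination)
    }

  admissible⇒truncated : ∀ {a b} → Admissible a b → a ∸ 1 + (n ∸ b) ≤ suc m
  admissible⇒truncated {suc a} (_ , a+1<b , b≤n) =
    ≤-trans (+-monoʳ-≤ a (∸-monoʳ-≤ n a+1<b))
            (≤-reflexive (m+[n∸m]≡n {a} {suc m} (≤-pred (≤-pred (≤-trans a+1<b b≤n)))))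

  truncated⇒admissible : ∀ {x y} → x + y ≤ suc m → Admissible (suc x) (n ∸ y)
  truncated⇒admissible {x} {y} x+y≤m+1 = s≤s z≤n , m+n≤o⇒m≤o∸n (suc (suc x)) (s≤s (s≤s x+y≤m+1)) , m∸n≤m n y

  SET≅Trunc : PosetIso {SET (L11 n)} {Trunc n} (_≈SET_ {L11 n}) (_≤SET_ {L11 n}) (_≈Tr_ {n}) (TruncLeq n)
  SET≅Trunc = record
    { to = λ S → (bottomOf S ∸ 1 , n ∸ topOf S) , admissible⇒truncated (admissible S)
    ; from = λ q → fillSET (truncated⇒admissible (proj₂ q))
    ; to-cong = λ _ _ S≡S' → cong (λ T → bottomClaw T ∸ 1 , n ∸ topClaw T) S≡S'
    ; from-cong = λ _ _ q≡q' → cong (λ (x , y) → fill (suc x) (n ∸ y)) q≡q'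
    ; from∘to = λ S → let 1≤a , _ , b≤n = admissible S in
        trans (cong₂ fill (suc[a∸1]≡a 1≤a) (m∸[m∸n]≡n b≤n)) (sym (≡fill S))
    ; to∘from = λ { ((x , y) , x+y≤m+1) → cong (x ,_) (trans (cong (n ∸_) (topClaw-fill (suc x) (n ∸ y)))
                      (m∸[m∸n]≡n (≤-trans (m≤n+m y x) (≤-trans x+y≤m+1 (≤-trans (n≤1+n _) (n≤1+n _)))))) }
    ; monotone = λ S T S≤T → let a'≤a , b≤b' = Equivalence.to (≤SET⇔ S T) S≤T in
        ∸-monoˡ-≤ 1 a'≤a , ∸-monoʳ-≤ n b≤b'
    ; reflects = λ S T (a'-1≤a-1 , n-b'≤n-b) → Equivalence.from (≤SET⇔ S T)
        ( subst₂ _≤_ (suc[a∸1]≡a (proj₁ (admissible T))) (suc[a∸1]≡a (proj₁ (admissible S))) (s≤s a'-1≤a-1)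
        , ∸-cancelʳ-≤ (proj₂ (proj₂ (admissible S))) n-b'≤n-b)
    }

  entryAt-fill : ∀ {a b} → Admissible a b →
    entryAt (zip Cells (fill a b)) (1 , n) ≡ just a × entryAt (zip Cells (fill a b)) (3 , n) ≡ just b
  entryAt-fill {a} {b} adm = trans (cong (λ l → entryAt l (1 , n)) (zip-fill adm)) bottomEntry
                           , trans (cong (λ l → entryAt l (3 , n)) (zip-fill adm)) topEntry
    where
    bottomEntry : entryAt (((1 , n) , a) ∷ rowFilling 2 2 (body a b) ++ ((3 , n) , b) ∷ []) (1 , n) ≡ just a
    bottomEntry rewrite ≡ᵇ-refl n = refl
    topEntry : entryAt (((1 , n) , a) ∷ rowFilling 2 2 (body a b) ++ ((3 , n) , b) ∷ []) (3 , n) ≡ just b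
    topEntry = trans (entryAt-rowFilling 2 2 (body a b) (((3 , n) , b) ∷ []) (λ ())) lastEntry
      where
      lastEntry : entryAt (((3 , n) , b) ∷ []) (3 , n) ≡ just b
      lastEntry rewrite ≡ᵇ-refl n = refl

  ClawEntries : List Cell → Filling → Set
  ClawEntries cs T = entryAt (zip cs T) (1 , n) ≡ just (bottomClaw T) × entryAt (zip cs T) (3 , n) ≡ just (topClaw T)

  ClawsAre⇔ : ∀ S i → ClawsAre n i (proj₁ S) ⇔ (bottomOf S ≡ i × topOf S ≡ suc i)
  ClawsAre⇔ S i = mk⇔ to from
    where
    entries : ClawEntries (L11 n) (proj₁ S)
    entries = subst (λ cs → ClawEntries cs (proj₁ S)) (sym L11≡Cells)
      (subst (ClawEntries Cells) (sym (≡fill S))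
        (proj₁ (entryAt-fill (admissible S)) ,
         trans (proj₂ (entryAt-fill (admissible S))) (cong just (sym (topClaw-fill (bottomOf S) (topOf S))))))
    to : ClawsAre n i (proj₁ S) → bottomOf S ≡ i × topOf S ≡ suc i
    to (inj₁ (bottom≡ , top≡)) = just-injective (trans (sym (proj₁ entries)) bottom≡)
                               , just-injective (trans (sym (proj₂ entries)) top≡)
    to (inj₂ (bottom≡ , top≡)) = ⊥-elim (<-asym (proj₁ (proj₂ (admissible S)))
      (subst₂ _<_ (just-injective (trans (sym top≡) (proj₂ entries)))
                  (just-injective (trans (sym bottom≡) (proj₁ entries)))
        (n<1+n i)))
    from : bottomOf S ≡ i × topOf S ≡ suc i → ClawsAre n i (proj₁ S)
    from (refl , top≡) = inj₁ (proj₁ entries , trans (proj₂ entries) (cong just top≡))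

  adjacent⇒minimal : ∀ M → topOf M ≡ suc (bottomOf M) → IsMinimal (L11 n) M
  adjacent⇒minimal M top≡bottom+1 S S≤M = trans (≡fill S) (trans (cong₂ fill a≡ b≡) (sym (≡fill M)))
    where
    aM≤aS : bottomOf M ≤ bottomOf S
    aM≤aS = proj₁ (Equivalence.to (≤SET⇔ S M) S≤M)
    bS≤aM+1 : topOf S ≤ suc (bottomOf M)
    bS≤aM+1 = subst (topOf S ≤_) top≡bottom+1 (proj₂ (Equivalence.to (≤SET⇔ S M) S≤M))
    aS<bS : bottomOf S < topOf S
    aS<bS = proj₁ (proj₂ (admissible S))
    a≡ : bottomOf S ≡ bottomOf M
    a≡ = ≤-antisym (≤-pred (<-≤-trans aS<bS bS≤aM+1)) aM≤aS
    b≡ : topOf S ≡ topOf M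
    b≡ = trans (≤-antisym bS≤aM+1 (subst (λ a → suc a ≤ topOf S) a≡ aS<bS)) (sym top≡bottom+1)

  -- Raising the bottom claw by one gives a strictly smaller tableau unless the claws are adjacent.
  minimal⇒adjacent : ∀ T → IsMinimal (L11 n) T → topOf T ≡ suc (bottomOf T)
  minimal⇒adjacent T T-minimal with topOf T ≤? suc (bottomOf T)
  ... | yes b≤a+1 = ≤-antisym b≤a+1 (proj₁ (proj₂ (admissible T)))
  ... | no b≰a+1 = ⊥-elim (1+n≢n (cong bottomClaw (T-minimal S S≤T)))
    where
    S : SET (L11 n)
    S = fillSET (s≤s z≤n , ≰⇒> b≰a+1 , proj₂ (proj₂ (admissible T)))
    S≤T : _≤SET_ {L11 n} S T
    S≤T = Equivalence.from (≤SET⇔ S T) (n≤1+n (bottomOf T) , ≤-reflexive (topClaw-fill (suc (bottomOf T)) (topOf T)))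

  body-adjacent : ∀ p k → p + k ≡ suc m → body (suc p) (2 + p) ≡ interval 1 p ++ interval (3 + p) k
  body-adjacent p k p+k≡m+1 = begin
    filter other?′ (interval 1 n)
      ≡⟨ cong (filter other?′ ∘ interval 1) n≡ ⟩
    filter other?′ (interval 1 (p + (2 + k)))
      ≡⟨ cong (filter other?′) (interval-++ 1 p (2 + k)) ⟩
    filter other?′ (interval 1 p ++ suc p ∷ 2 + p ∷ interval (3 + p) k)
      ≡⟨ filter-++ other?′ (interval 1 p) _ ⟩
    filter other?′ (interval 1 p) ++ filter other?′ (suc p ∷ 2 + p ∷ interval (3 + p) k)
      ≡⟨ cong₂ _++_ (filter-all other?′ below) claws-removed ⟩
    interval 1 p ++ interval (3 + p) k ∎
    where
    open ≡-Reasoning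
    other?′ : Decidable (Other (suc p) (2 + p))
    other?′ = other? (suc p) (2 + p)
    n≡ : n ≡ p + (2 + k)
    n≡ = trans (cong (suc ∘ suc) (sym p+k≡m+1)) (sym (trans (+-suc p (suc k)) (cong suc (+-suc p k))))
    below : All (Other (suc p) (2 + p)) (interval 1 p)
    below = All.tabulate λ v∈ → let v<p+1 = proj₂ (∈-interval⁻ 1 p v∈) in <⇒≢ v<p+1 , <⇒≢ (m<n⇒m<1+n v<p+1)
    above : All (Other (suc p) (2 + p)) (interval (3 + p) k)
    above = All.tabulate λ v∈ → let p+3≤v = proj₁ (∈-interval⁻ (3 + p) k v∈) in
      (<⇒≢ (<-trans (n<1+n _) p+3≤v) ∘ sym) , (<⇒≢ p+3≤v ∘ sym)
    claws-removed : filter other?′ (suc p ∷ 2 + p ∷ interval (3 + p) k) ≡ interval (3 + p) k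
    claws-removed rewrite dec-false (other?′ (suc p)) (λ (p+1≢p+1 , _) → p+1≢p+1 refl)
                        | dec-false (other?′ (2 + p)) (λ (_ , p+2≢p+2) → p+2≢p+2 refl) = filter-all other?′ above

  inversions-fill-adjacent : ∀ a → 1 ≤ a → suc a ≤ n →
    inversions (readingWord (fill a (suc a))) ≡ suc (suc m) + triangular (suc m)
  inversions-fill-adjacent (suc p) _ p+2≤n = begin
    inversions (reverse (suc p ∷ body (suc p) (2 + p) ++ (2 + p) ∷ []))
      ≡⟨ cong (λ B → inversions (reverse (suc p ∷ B ++ (2 + p) ∷ []))) (body-adjacent p k p+k≡m+1) ⟩
    inversions (reverse (suc p ∷ (interval 1 p ++ interval (3 + p) k) ++ (2 + p) ∷ []))
      ≡⟨ inversions-reverse-adjacentClaws p k ⟩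
    suc (p + k) + triangular (p + k)
      ≡⟨ cong (λ l → suc l + triangular l) p+k≡m+1 ⟩
    suc (suc m) + triangular (suc m) ∎
    where
    open ≡-Reasoning
    k : ℕ
    k = suc m ∸ p
    p+k≡m+1 : p + k ≡ suc m
    p+k≡m+1 = m+[n∸m]≡n (≤-pred (≤-pred p+2≤n))

  minimal-with-claws : ∀ i → 1 ≤ i → i < n →
    Σ (SET (L11 n)) λ M → ClawsAre n i (proj₁ M) × IsMinimal (L11 n) M
      × (∀ (T : SET (L11 n)) → ClawsAre n i (proj₁ T) → _≈SET_ {L11 n} T M)
  minimal-with-claws i 1≤i i<n = M , Equivalence.from (ClawsAre⇔ M i) (refl , claws) , adjacent⇒minimal M claws , unique
    where
    M : SET (L11 n)
    M = fillSET (1≤i , n<1+n i , i<n)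
    claws : topOf M ≡ suc i
    claws = topClaw-fill i (suc i)
    unique : ∀ T → ClawsAre n i (proj₁ T) → proj₁ T ≡ proj₁ M
    unique T T-claws = let bottom≡i , top≡i+1 = Equivalence.to (ClawsAre⇔ T i) T-claws in
      trans (≡fill T) (cong₂ fill bottom≡i top≡i+1)

  minimal⇒claws : ∀ (T : SET (L11 n)) → IsMinimal (L11 n) T →
    Σ ℕ λ i → 1 ≤ i × i < n × ClawsAre n i (proj₁ T)
  minimal⇒claws T T-minimal = bottomOf T , proj₁ (admissible T) ,
    subst (_≤ n) (minimal⇒adjacent T T-minimal) (proj₂ (proj₂ (admissible T))) ,
    Equivalence.from (ClawsAre⇔ T (bottomOf T)) (refl , minimal⇒adjacent T T-minimal)

  minimal-inversions : ∀ (T : SET (L11 n)) → IsMinimal (L11 n) T →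
    inversions (readingWord (proj₁ T)) ≡ suc (suc m) + triangular (suc m)
  minimal-inversions T T-minimal =
    trans (cong (inversions ∘ readingWord) (trans (≡fill T) (cong (fill (bottomOf T)) adjacent)))
      (inversions-fill-adjacent (bottomOf T) (proj₁ (admissible T))
        (subst (_≤ n) adjacent (proj₂ (proj₂ (admissible T)))))
    where
    adjacent : topOf T ≡ suc (bottomOf T)
    adjacent = minimal⇒adjacent T T-minimal

  SET-enumeration : Σ (List Filling) λ Ls → Unique Ls × (∀ T → (T ∈ Ls) ⇔ IsSET (L11 n) T) × length Ls ≡ n C 2
  SET-enumeration = fillings , Unique.map⁺ fill-injective (pairs-unique n) , (λ T → mk⇔ to from) ,
                    trans (length-map (uncurry fill) (pairs n)) (length-pairs n)
    where
    fillings : List Filling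
    fillings = map (uncurry fill) (pairs n)
    to : ∀ {T} → T ∈ fillings → IsSET (L11 n) T
    to T∈ with ∈-map⁻ (uncurry fill) T∈
    ... | (a , b) , ab∈ , refl = subst (λ cs → IsSET cs (fill a b)) (sym L11≡Cells) (fill-isSET (∈-pairs⁻ n ab∈))
    from : ∀ {T} → IsSET (L11 n) T → T ∈ fillings
    from {T} T-SET with isSET⇒fill (subst (λ cs → IsSET cs T) L11≡Cells T-SET)
    ... | (1≤a , a<b , b≤n) , T≡fill =
      subst (_∈ fillings) (sym T≡fill) (∈-map⁺ (uncurry fill) (∈-pairs⁺ n 1≤a a<b b≤n))

proposition18 : (n : ℕ) → 3 ≤ n →
    PosetIso {SET (L11 n)} {Root n} (_≈SET_ {L11 n}) (_≤SET_ {L11 n}) (_≈R_ {n}) (RootLeq n)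
    × PosetIso {SET (L11 n)} {Trunc n} (_≈SET_ {L11 n}) (_≤SET_ {L11 n}) (_≈Tr_ {n}) (TruncLeq n)
    × (∀ i → 1 ≤ i → i < n →
         Σ (SET (L11 n)) λ M → ClawsAre n i (proj₁ M) × IsMinimal (L11 n) M
           × (∀ (T : SET (L11 n)) → ClawsAre n i (proj₁ T) → _≈SET_ {L11 n} T M))
    × (∀ (T : SET (L11 n)) → IsMinimal (L11 n) T →
         Σ ℕ λ i → 1 ≤ i × i < n × ClawsAre n i (proj₁ T))
    × (∀ (T T' : SET (L11 n)) → IsMinimal (L11 n) T → IsMinimal (L11 n) T' →
         inversions (readingWord (proj₁ T)) ≡ inversions (readingWord (proj₁ T')))
    × (Σ (List Filling) λ Ls → Unique Ls × (∀ T → (T ∈ Ls) ⇔ IsSET (L11 n) T)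
         × length Ls ≡ n C 2)
proposition18 (suc zero) (s≤s ())
proposition18 (suc (suc zero)) (s≤s (s≤s ()))
proposition18 (suc (suc (suc m))) _ =
  SET≅Root , SET≅Trunc , minimal-with-claws , minimal⇒claws ,
  (λ T T' T-minimal T'-minimal →
     trans (minimal-inversions T T-minimal) (sym (minimal-inversions T' T'-minimal))) ,
  SET-enumeration
  where open Lobster m
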